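{- Let $b=\mathrm{bc}(\mathbf{G}_S)$. The set $C_S := [0..c_{\mathrm{pref}}]\cup[c_{\mathrm{suff}}..b)\cup[c_{\mathrm{lsuff}}..c_{\mathrm{lpref}}]\cup C_S^{0,b-1}$ is a period cover with respect to $w_S$, where: (a) $c_{\mathrm{pref}}\in[0..b)$ is the largest index with $|\mathsf{LZ}(T[\tau_0^0..\tau_0^{c_{\mathrm{pref}}}])|\le 12w+22k$; (b) $c_{\mathrm{suff}}\in[0..b)$ is the smallest index with $|\mathsf{LZ}(\mathrm{rev}(T[\tau_0^{c_{\mathrm{suff}}}..\tau_0^{b-1}]))|\le 12w+22k$; (c) $c_{\mathrm{lsuff}}\in[0..c_{\mathrm{last}}]$ is the smallest index with $|\mathsf{LZ}(\mathrm{rev}(T[\tau_0^{c_{\mathrm{lsuff}}}..\tau_0^{c_{\mathrm{last}}}]))|\le 12w+22k$; (d) $c_{\mathrm{lpref}}\in[c_{\mathrm{last}}+1..b)$ is the largest index with $|\mathsf{LZ}(T[\tau_0^{c_{\mathrm{last}}+1}..\tau_0^{c_{\mathrm{lpref}}}])|\le 12w+22k$; (e) for $[i..j]\subseteq[0..b)$, $C_S^{i,j}$ is defined recursively: if $\sum_{c=i-1}^{j}w_S(c)=0$ then $C_S^{i,j}=\varnothing$; else if $i=j$ then $C_S^{i,j}=\{i\}$; otherwise, with $h=\lfloor(i+j)/2\rfloor$, let $i'\in[i..h]$ be the smallest index with $|\mathsf{LZ}(\mathrm{rev}(T[\tau_0^{i'}..\tau_0^{h}]))|\le 12\sum_{c=i-1}^{j}w_S(c)$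 and $j'\in[h..j]$ the largest index with $|\mathsf{LZ}(T(\tau_0^{h}..\tau_0^{j'}])|\le 12\sum_{c=i-1}^{j}w_S(c)$, and set $C_S^{i,j}=C_S^{i,h}\cup C_S^{h+1,j}\cup[i'..j']$.
   Context: Notation: $[i..j]=\{i,\dots,j\}$, $[i..j)=\{i,\dots,j-1\}$; $X[i..j)=X[i]\cdots X[j-1]$, $X[i..j]=X[i..j+1)$, $X(i..j]=X[i+1..j]$; $\mathrm{rev}(X)$ is the reversal of $X$. $\mathsf{LZ}(X)$ is the LZ77 factorization of $X$ (greedy left-to-right parsing into phrases, each either a single character or the longest fragment starting at the current position that has an earlier occurrence in $X$), and $|\mathsf{LZ}(X)|$ its number of phrases. An alignment of $X[x..x')$ onto $Y[y..y')$ is a sequence $(x_t,y_t)_{t=0}^{\ell}$ from $(x,y)$ to $(x',y')$ with steps $(+1,+1)$ (aligns $X[x_t]$ with $Y[y_t]$; a match if equal, a substitution otherwise), $(+1,0)$ (deletes $X[x_t]$), $(0,+1)$ (inserts $Y[y_t]$); its cost is the number of insertions, deletions and substitutions; $\delta_E$ is the minimum cost (edit distance). The self-edit distance $\mathrm{selfed}(X)$ is the minimum cost of an alignment of $X$ onto $X$ that never aligns a character $X[x]$ with itself. Fix $k$ and strings $P,T$, and a set $S$ of alignments of $P$ onto fragments of $T$, each of cost at most $k$. The graph $\mathbf{G}_S$ has one vertex per character of $P$, one per character of $T$, and a special vertex $\bot$; for each alignment in $S$ it has an edge $\{P[x],\bot\}$ for each deleted $P[x]$, $\{\bot,T[y]\}$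 for each inserted $T[y]$, and $\{P[x],T[y]\}$ for each aligned pair; an edge is black if the pair is matched and red otherwise. A component is red if it has a red edge, black otherwise; $\mathrm{bc}(\mathbf{G}_S)$ is the number of black components. Assume $S$ encloses $T$, i.e., $|T|\le 2|P|-2k$ and $S$ contains alignments $\mathcal{X}_{\mathrm{pref}}\ni(0,0)$ and $\mathcal{X}_{\mathrm{suf}}\ni(|P|,|T|)$, and assume $\mathrm{bc}(\mathbf{G}_S)>0$. Let $P_{|S}$ ($T_{|S}$) be the subsequence of characters of $P$ ($T$) lying in black components. For every $c\in[0..\mathrm{bc}(\mathbf{G}_S))$ there is a black component (the $c$-th black component) consisting exactly of the characters $P_{|S}[i]$ and $T_{|S}[i]$ with $i\equiv c \pmod{\mathrm{bc}(\mathbf{G}_S)}$, and the last characters of $P_{|S}$ and $T_{|S}$ lie in the same component, with index $c_{\mathrm{last}}$. Let $m_c=\lceil(|P_{|S}|-c)/\mathrm{bc}(\mathbf{G}_S)\rceil$, $n_c=\lceil(|T_{|S}|-c)/\mathrm{bc}(\mathbf{G}_S)\rceil$, $\pi_j^c$ ($j\in[0..m_c)$) the position in $P$ of $P_{|S}[c+j\,\mathrm{bc}(\mathbf{G}_S)]$, and $\tau_i^c$ ($i\in[0..n_c)$) the position in $T$ of $T_{|S}[c+i\,\mathrm{bc}(\mathbf{G}_S)]$; by convention, with $b=\mathrm{bc}(\mathbf{G}_S)$, $m_b=m_0-1$, $\pi_j^b=\pi_{j+1}^0$, $n_b=n_0-1$, $\tau_i^b=\tau_{i+1}^0$. A weight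 function $w_S:[0..b)\to\mathbb{Z}_{\ge0}$ covers $S$ if: (1) $w_S(c)\ge\delta_E(P[\pi_j^c..\pi_j^{c+1}),T[\tau_i^c..\tau_i^{c+1}))$ for all $c\in[0..b)$, $j\in[0..m_{c+1})$, $i\in[0..n_{c+1})$; (2) $w_S(b-1)\ge\delta_E(P[0..\pi_0^0),T[0..\tau_0^0))$; (3) for every $i\in[1..n_0)$ some $t\in[\tau_{i-1}^{b-1}..\tau_i^0]$ satisfies $w_S(b-1)\ge\delta_E(P[0..\pi_0^0),T[t..\tau_i^0))$; (4) $w_S(c_{\mathrm{last}})\ge\delta_E(P[\pi_{m_0-1}^{c_{\mathrm{last}}}..|P|),T[\tau_{n_0-1}^{c_{\mathrm{last}}}..|T|))$; (5) for every $i\in[0..n_0-1)$ some $t'\in[\tau_i^{c_{\mathrm{last}}}..\tau_i^{c_{\mathrm{last}}+1}]$ satisfies $w_S(c_{\mathrm{last}})\ge\delta_E(P[\pi_{m_0-1}^{c_{\mathrm{last}}}..|P|),T[\tau_i^{c_{\mathrm{last}}}..t'))$. Fix such a covering $w_S$ with total weight $\sum_c w_S(c)\le w$, and set $w_S(-1)=w_S(b-1)$. A set $C_S\subseteq[0..b)$ is a period cover with respect to $w_S$ if $[a..b']\subseteq C_S$ for every interval $[a..b']\subseteq[0..b)$ such that either $\mathrm{selfed}(T[\tau_0^a..\tau_0^{b'}])\le 6w+11k$ and ($a=0$, or $b'=b-1$, or $b'=c_{\mathrm{last}}$, or $a=c_{\mathrm{last}}+1$), or $\mathrm{selfed}(T[\tau_0^a..\tau_0^{b'}])\le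 6\sum_{c=a-1}^{b'}w_S(c)$. -}

module Defs where

open import Data.Nat using (ℕ; zero; suc; _+_; _*_; _∸_; _≤_; _<_; _≤ᵇ_; _<ᵇ_; _≡ᵇ_)
open import Data.Nat.DivMod using (_/_; _%_)
open import Data.Bool using (Bool; true; false; not; _∧_; if_then_else_)
open import Data.List using (List; []; _∷_; length; take; drop; reverse; map; upTo)
open import Data.Nat.ListAction using (sum)
open import Data.Bool.ListAction using (any)
open import Data.List.Properties using (≡-dec)
open import Data.List.Membership.Propositional using (_∈_)
open import Data.List.Relation.Unary.All using (All)
open import Data.List.Relation.Unary.Any using (Any)
open import Data.List.Relation.Unary.AllPairs using (AllPairs)
open import Data.List.Relation.Unary.Linked using (Linked)
open import Data.Maybe using (Maybe; just; nothing)
open import Data.Product using (Σ; _×_; _,_; ∃)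
open import Data.Sum using (_⊎_)
open import Data.Empty using (⊥)
open import Relation.Nullary using (¬_)
open import Relation.Nullary.Decidable using (isYes)
open import Relation.Binary.Definitions using (DecidableEquality)
open import Relation.Binary.PropositionalEquality using (_≡_; _≢_)

-- ⌈ n / b ⌉ (0 when b = 0; only used with b > 0)
ceilDiv : ℕ → ℕ → ℕ
ceilDiv n zero = 0
ceilDiv n (suc b) = (n + b) / suc b

modN : ℕ → ℕ → ℕ
modN n zero = 0
modN n (suc b) = n % suc b

-- X[i] for a list of naturals (default 0 out of range; only used in range)
nth : List ℕ → ℕ → ℕ
nth [] _ = 0
nth (x ∷ _) zero = x
nth (_ ∷ xs) (suc n) = nth xs n

range : ℕ → ℕ → List ℕ
range lo hi = map (lo +_) (upTo (suc hi ∸ lo))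

firstSat : List ℕ → (ℕ → Bool) → Maybe ℕ
firstSat [] p = nothing
firstSat (x ∷ xs) p = if p x then just x else firstSat xs p

smallestIn : ℕ → ℕ → (ℕ → Bool) → Maybe ℕ
smallestIn lo hi p = firstSat (range lo hi) p

largestIn : ℕ → ℕ → (ℕ → Bool) → Maybe ℕ
largestIn lo hi p = firstSat (reverse (range lo hi)) p

InIvl : Maybe ℕ → Maybe ℕ → ℕ → Set
InIvl (just lo) (just hi) c = lo ≤ c × c ≤ hi
InIvl _ _ c = ⊥

-- Alignment steps: diag = (+1,+1), del = (+1,0), ins = (0,+1)

data Step : Set where
  diag del ins : Step

-- Vertices of the graph G_S: P[x], T[y], and ⊥
data V : Set where
  pv tv : ℕ → V
  bot : V

-- An alignment of P onto the fragment T[ystart..yend)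
record Alignment : Set where
  constructor mkAlignment
  field
    ystart : ℕ
    yend   : ℕ
    steps  : List Step

open Alignment public

module _ {A : Set} (_≟_ : DecidableEquality A) where

  sub : List A → ℕ → ℕ → List A
  sub X i j = take (j ∸ i) (drop i X)

  mis : A → A → ℕ
  mis x y = if isYes (x ≟ y) then 0 else 1

  data Al : List A → List A → List Step → ℕ → Set where
    al-nil  : Al [] [] [] 0
    al-diag : ∀ {x y xs ys st c} → Al xs ys st c → Al (x ∷ xs) (y ∷ ys) (diag ∷ st) (mis x y + c)
    al-del  : ∀ {x xs ys st c} → Al xs ys st c → Al (x ∷ xs) ys (del ∷ st) (suc c)
    al-ins  : ∀ {y xs ys st c} → Al xs ys st c → Al xs (y ∷ ys) (ins ∷ st) (suc c)

  EDle : List A → List A → ℕ → Set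
  EDle X Y d = Σ (List Step) λ st → Σ ℕ λ c → Al X Y st c × c ≤ d

  data NoSelf : ℕ → ℕ → List Step → Set where
    ns-nil  : ∀ {x y} → NoSelf x y []
    ns-diag : ∀ {x y st} → x ≢ y → NoSelf (suc x) (suc y) st → NoSelf x y (diag ∷ st)
    ns-del  : ∀ {x y st} → NoSelf (suc x) y st → NoSelf x y (del ∷ st)
    ns-ins  : ∀ {x y st} → NoSelf x (suc y) st → NoSelf x y (ins ∷ st)

  SelfedLE : List A → ℕ → Set
  SelfedLE X d = Σ (List Step) λ st → Σ ℕ λ c → Al X X st c × NoSelf 0 0 st × c ≤ d

  matchAt : List A → ℕ → ℕ → ℕ → Bool
  matchAt X j i ℓ = isYes (≡-dec _≟_ (take ℓ (drop j X)) (take ℓ (drop i X))) ∧ (i + ℓ ≤ᵇ length X)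

  earlierOcc : List A → ℕ → ℕ → Bool
  earlierOcc X i ℓ = any (λ j → matchAt X j i ℓ) (upTo i)

  longestDown : List A → ℕ → ℕ → ℕ
  longestDown X i zero = 0
  longestDown X i (suc l) = if earlierOcc X i (suc l) then suc l else longestDown X i l

  phraseLen : List A → ℕ → ℕ
  phraseLen X i with longestDown X i (length X ∸ i)
  ... | zero = 1
  ... | suc l = suc l

  lzFrom : List A → ℕ → ℕ → ℕ
  lzFrom X zero i = 0
  lzFrom X (suc f) i = if i <ᵇ length X then suc (lzFrom X f (i + phraseLen X i)) else 0

  lzSize : List A → ℕ
  lzSize X = lzFrom X (length X) 0

  Edge : Set
  Edge = V × V × Bool   -- Bool: true = red, false = black

  edgesW : List A → List A → ℕ → ℕ → List Step → List Edge
  edgesW (x ∷ xs) (y ∷ ys) px py (diag ∷ st) = (pv px , tv py , not (isYes (x ≟ y))) ∷ edgesW xs ys (suc px) (suc py) st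
  edgesW (x ∷ xs) ys px py (del ∷ st) = (pv px , bot , true) ∷ edgesW xs ys (suc px) py st
  edgesW xs (y ∷ ys) px py (ins ∷ st) = (bot , tv py , true) ∷ edgesW xs ys px (suc py) st
  edgesW _ _ _ _ _ = []

  edgesOf : List A → List A → Alignment → List Edge
  edgesOf P T a = edgesW P (sub T (ystart a) (yend a)) 0 (ystart a) (steps a)

  EdgeS : List A → List A → List Alignment → V → V → Bool → Set
  EdgeS P T S u v r = Σ Alignment λ a → a ∈ S × (u , v , r) ∈ edgesOf P T a

  data Conn (P T : List A) (S : List Alignment) : V → V → Set where
    here : ∀ {x} → Conn P T S x x
    fwd  : ∀ {x y z r} → EdgeS P T S x y r → Conn P T S y z → Conn P T S x z
    bwd  : ∀ {x y z r} → EdgeS P T S y x r → Conn P T S y z → Conn P T S x z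

  Black : List A → List A → List Alignment → V → Set
  Black P T S v = ∀ u u' → EdgeS P T S u u' true → ¬ Conn P T S v u

  IsChar : List A → List A → V → Set
  IsChar P T (pv x) = x < length P
  IsChar P T (tv y) = y < length T
  IsChar P T bot = ⊥

  -- b is the number of black components (of G_S) containing characters of P or T
  BlackCount : List A → List A → List Alignment → ℕ → Set
  BlackCount P T S b =
    Σ (List V) λ R → length R ≡ b
      × All (λ v → IsChar P T v × Black P T S v) R
      × AllPairs (λ u v → ¬ Conn P T S u v) R
      × (∀ v → IsChar P T v → Black P T S v → Any (Conn P T S v) R)

  -- Ps lists, increasingly, the positions x of P with P[x] in a black component (i.e. P_{|S})
  IsPS : List A → List A → List Alignment → List ℕ → Set
  IsPS P T S Ps = Linked _<_ Ps
    × (∀ x → (x ∈ Ps → x < length P × Black P T S (pv x)) × (x < length P → Black P T S (pv x) → x ∈ Ps))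

  -- Ts lists, increasingly, the positions y of T with T[y] in a black component (i.e. T_{|S})
  IsTS : List A → List A → List Alignment → List ℕ → Set
  IsTS P T S Ts = Linked _<_ Ts
    × (∀ y → (y ∈ Ts → y < length T × Black P T S (tv y)) × (y < length T → Black P T S (tv y) → y ∈ Ts))

  ValidS : List A → List A → ℕ → List Alignment → Set
  ValidS P T k S = All (λ a → ystart a ≤ yend a × yend a ≤ length T
                       × Σ ℕ λ c → Al P (sub T (ystart a) (yend a)) (steps a) c × c ≤ k) S

  Encloses : List A → List A → ℕ → List Alignment → Set
  Encloses P T k S = length T + 2 * k ≤ 2 * length P
    × (Σ Alignment λ a → a ∈ S × ystart a ≡ 0)
    × (Σ Alignment λ a → a ∈ S × yend a ≡ length T)

  module Derived (P T : List A) (k w b : ℕ) (Ps Ts : List ℕ) (wS : ℕ → ℕ) where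

    -- π^c_j and τ^c_i (the conventions for c = b are the same formula)
    π : ℕ → ℕ → ℕ
    π c j = nth Ps (c + j * b)

    τ : ℕ → ℕ → ℕ
    τ c i = nth Ts (c + i * b)

    m : ℕ → ℕ
    m c = ceilDiv (length Ps ∸ c) b

    n : ℕ → ℕ
    n c = ceilDiv (length Ts ∸ c) b

    clast : ℕ
    clast = modN (length Ps ∸ 1) b

    Covers : Set
    Covers =
      (∀ c → c < b → ∀ j → j < m (suc c) → ∀ i → i < n (suc c) →
         EDle (sub P (π c j) (π (suc c) j)) (sub T (τ c i) (τ (suc c) i)) (wS c))
      × EDle (sub P 0 (π 0 0)) (sub T 0 (τ 0 0)) (wS (b ∸ 1))
      × (∀ i → 1 ≤ i → i < n 0 → Σ ℕ λ t → τ (b ∸ 1) (i ∸ 1) ≤ t × t ≤ τ 0 i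
           × EDle (sub P 0 (π 0 0)) (sub T t (τ 0 i)) (wS (b ∸ 1)))
      × EDle (sub P (π clast (m 0 ∸ 1)) (length P)) (sub T (τ clast (n 0 ∸ 1)) (length T)) (wS clast)
      × (∀ i → suc i < n 0 → Σ ℕ λ t' → τ clast i ≤ t' × t' ≤ τ (suc clast) i
           × EDle (sub P (π clast (m 0 ∸ 1)) (length P)) (sub T (τ clast i) t') (wS clast))

    -- w_S(-1) := w_S(b-1)
    wS' : ℕ → ℕ
    wS' zero = wS (b ∸ 1)
    wS' (suc i) = wS i

    -- Σ_{c=i-1}^{j} w_S(c)
    W : ℕ → ℕ → ℕ
    W i j = wS' i + sum (map wS (range i j))

    Tij : ℕ → ℕ → List A
    Tij i j = sub T (τ i 0) (suc (τ j 0))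

    IsPeriodCover : (ℕ → Set) → Set
    IsPeriodCover C = ∀ a b' → a ≤ b' → b' < b →
      ((SelfedLE (Tij a b') (6 * w + 11 * k)
          × (a ≡ 0 ⊎ b' ≡ b ∸ 1 ⊎ b' ≡ clast ⊎ a ≡ suc clast))
       ⊎ SelfedLE (Tij a b') (6 * W a b')) →
      ∀ c → a ≤ c → c ≤ b' → C c

    bound : ℕ
    bound = 12 * w + 22 * k

    cpref : Maybe ℕ
    cpref = largestIn 0 (b ∸ 1) (λ c → lzSize (Tij 0 c) ≤ᵇ bound)

    csuff : Maybe ℕ
    csuff = smallestIn 0 (b ∸ 1) (λ c → lzSize (reverse (Tij c (b ∸ 1))) ≤ᵇ bound)

    clsuff : Maybe ℕ
    clsuff = smallestIn 0 clast (λ c → lzSize (reverse (Tij c clast)) ≤ᵇ bound)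

    -- if [c_last+1..b) is empty, the interval [c_lsuff..c_lpref] is read as [c_lsuff..c_last]
    clpref : Maybe ℕ
    clpref = if suc clast <ᵇ b
             then largestIn (suc clast) (b ∸ 1) (λ c → lzSize (Tij (suc clast) c) ≤ᵇ bound)
             else just clast

    -- membership in C^{i,j}_S (fuel-driven recursion; fuel j-i+1 suffices)
    memC : ℕ → ℕ → ℕ → ℕ → Set
    memC zero i j c = ⊥
    memC (suc f) i j c =
      if W i j ≡ᵇ 0 then ⊥ else
      (if i ≡ᵇ j then c ≡ i else
        (memC f i h c ⊎ memC f (suc h) j c
          ⊎ InIvl (smallestIn i h (λ i' → lzSize (reverse (Tij i' h)) ≤ᵇ 12 * W i j))
                  (largestIn h j (λ j' → lzSize (sub T (suc (τ h 0)) (suc (τ j' 0))) ≤ᵇ 12 * W i j))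
                  c))
      where
        h : ℕ
        h = (i + j) / 2

    CS : ℕ → Set
    CS c = InIvl (just 0) cpref c
         ⊎ InIvl csuff (just (b ∸ 1)) c
         ⊎ InIvl clsuff clpref c
         ⊎ memC b 0 (b ∸ 1) c

{-# OPTIONS --safe #-}
-- A self-alignment of X of cost d yields a factorization of X into at most 2d phrases, each a
-- single character or a copy of an earlier fragment: while the alignment path stays off the
-- diagonal, its runs of matches copy a fragment starting further left, and every edit operation
-- ends the current run and adds at most one single character. Greedy LZ77 parsing is optimal among
-- such factorizations, so |LZ(X)| ≤ 2 selfed(X). Self-edit distance does not grow when passing to a
-- suffix or to the reversal, so a window T[τ₀ᵃ..τ₀ᵇ′] with selfed ≤ D has all its suffixes and all
-- its reversed prefixes of LZ size ≤ 2D. The thresholds 12w+22k and 12 Σ w_S used for c_pref,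
-- c_suff, c_lsuff, c_lpref and for the sets C_S^{i,j} are exactly these 2D, so every interval
-- [a..b′] required by the definition of a period cover lies between the corresponding indices.
-- Windows are non-empty because b ≤ |T_{|S}| (distinct black components contain distinct
-- characters of T), which keeps the thresholds positive.

module Submission where

open import Defs
open import Data.Nat
  using (ℕ; zero; suc; _+_; _*_; _∸_; _≤_; _<_; _≤ᵇ_; _<ᵇ_; _≡ᵇ_; ∣_-_∣; z≤n; s≤s; z<s)
open import Data.Nat.Properties
open import Data.Bool using (Bool; true; false)
open import Data.Bool.Properties using (T-≡)
open import Data.Bool.ListAction using (any)
open import Data.List
  using (List; []; _∷_; [_]; _++_; length; take; drop; reverse; map; upTo; applyUpTo; applyDownFrom)
open import Data.List.Properties
  using (≡-dec; ∷-injective; ++-identityʳ; map-cong; map-upTo; map-applyUpTo; take-take; take-drop; drop-drop;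
         take++drop≡id; drop-all; length-take; length-drop; length-reverse; unfold-reverse; reverse-++;
         reverse-applyUpTo)
open import Data.Nat.ListAction using (sum)
open import Data.Nat.DivMod using (_/_; m%n<n; m*n/n≡m; /-monoˡ-≤; m<n*o⇒m/o<n)
open import Data.Maybe using (Maybe; just)
open import Data.Product using (Σ; ∃-syntax; _×_; _,_; proj₁; proj₂)
open import Data.Sum using (_⊎_; inj₁; inj₂; map₁; map₂)
open import Data.Empty using (⊥-elim)
open import Data.List.Membership.Propositional using (_∈_)
open import Data.List.Relation.Unary.All as All using (All; []; _∷_)
open import Data.List.Relation.Unary.Any using (here; there)
open import Data.List.Relation.Unary.AllPairs using (AllPairs; []; _∷_)
open import Data.List.Relation.Unary.Linked using (Linked)
open import Data.List.Relation.Unary.Linked.Properties using (Linked⇒AllPairs)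
open import Data.List.Relation.Binary.Pointwise using (Pointwise; []; _∷_; Pointwise-length)
open import Function using (id; _∘_; Equivalence)
open import Relation.Nullary using (¬_; yes; no)
open import Relation.Binary.Definitions using (DecidableEquality)
open import Relation.Binary.PropositionalEquality hiding ([_])

≤⇒≤ᵇ≡true : ∀ {m n} → m ≤ n → (m ≤ᵇ n) ≡ true
≤⇒≤ᵇ≡true = Equivalence.to T-≡ ∘ ≤⇒≤ᵇ

<⇒<ᵇ≡true : ∀ {m n} → m < n → (m <ᵇ n) ≡ true
<⇒<ᵇ≡true = Equivalence.to T-≡ ∘ <⇒<ᵇ

∣1+m-n∣≤1+∣m-n∣ : ∀ m n → ∣ suc m - n ∣ ≤ suc ∣ m - n ∣
∣1+m-n∣≤1+∣m-n∣ zero    zero    = ≤-refl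
∣1+m-n∣≤1+∣m-n∣ zero    (suc n) = m≤n⇒m≤1+n (n≤1+n n)
∣1+m-n∣≤1+∣m-n∣ (suc m) zero    = ≤-refl
∣1+m-n∣≤1+∣m-n∣ (suc m) (suc n) = ∣1+m-n∣≤1+∣m-n∣ m n

∣m-1+n∣≤1+∣m-n∣ : ∀ m n → ∣ m - suc n ∣ ≤ suc ∣ m - n ∣
∣m-1+n∣≤1+∣m-n∣ m n =
  subst₂ (λ u v → u ≤ suc v) (∣-∣-comm (suc n) m) (∣-∣-comm n m) (∣1+m-n∣≤1+∣m-n∣ n m)

m+m≡m*2 : ∀ m → m + m ≡ m * 2
m+m≡m*2 m = sym (trans (*-comm m 2) (cong (m +_) (+-identityʳ m)))

m≤[m+n]/2 : ∀ {m n} → m ≤ n → m ≤ (m + n) / 2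
m≤[m+n]/2 {m} {n} m≤n =
  subst (_≤ (m + n) / 2) (m*n/n≡m m 2) (/-monoˡ-≤ 2 (subst (_≤ m + n) (m+m≡m*2 m) (+-monoʳ-≤ m m≤n)))

[m+n]/2<n : ∀ {m n} → m < n → (m + n) / 2 < n
[m+n]/2<n {m} {n} m<n = m<n*o⇒m/o<n (subst (m + n <_) (m+m≡m*2 n) (+-monoˡ-< n m<n))

<⇒≤∸1 : ∀ {m n} → m < n → m ≤ n ∸ 1
<⇒≤∸1 (s≤s m≤n) = m≤n

modN<n : ∀ m {n} → 0 < n → modN m n < n
modN<n m {suc n} _ = m%n<n m (suc n)

any-applyUpTo : ∀ {B : Set} (p : B → Bool) (f : ℕ → B) {n t} → t < n → p (f t) ≡ true →
                any p (applyUpTo f n) ≡ true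
any-applyUpTo p f {suc n} {zero} _ pt rewrite pt = refl
any-applyUpTo p f {suc n} {suc t} (s≤s t<n) pt with p (f 0)
... | true  = refl
... | false = any-applyUpTo p (f ∘ suc) t<n pt

module _ {B : Set} where

  drop-∷⇒drop-suc : ∀ x (L : List B) {a L′} → drop x L ≡ a ∷ L′ → drop (suc x) L ≡ L′
  drop-∷⇒drop-suc zero    (_ ∷ L) refl = refl
  drop-∷⇒drop-suc (suc x) (_ ∷ L) eq   = drop-∷⇒drop-suc x L eq

  drop-∷⇒< : ∀ x (L : List B) {a L′} → drop x L ≡ a ∷ L′ → x < length L
  drop-∷⇒< zero    (_ ∷ L) refl = s≤s z≤n
  drop-∷⇒< (suc x) (_ ∷ L) eq   = s≤s (drop-∷⇒< x L eq)

  drop-[]⇒length≤ : ∀ x (L : List B) → drop x L ≡ [] → length L ≤ x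
  drop-[]⇒length≤ x L eq = m∸n≡0⇒m≤n (trans (sym (length-drop x L)) (cong length eq))

  drop-∷-drop-suc : ∀ {y} (L : List B) → y < length L → ∃[ a ] drop y L ≡ a ∷ drop (suc y) L
  drop-∷-drop-suc {zero}  (a ∷ L) _         = a , refl
  drop-∷-drop-suc {suc y} (_ ∷ L) (s≤s y<L) = drop-∷-drop-suc L y<L

  take-suc-cong : ∀ {ℓ} (u v : List B) {a u′ v′} → take ℓ u ≡ take ℓ v →
                  drop ℓ u ≡ a ∷ u′ → drop ℓ v ≡ a ∷ v′ → take (suc ℓ) u ≡ take (suc ℓ) v
  take-suc-cong {zero}  (p ∷ u) (q ∷ v) _    refl refl = refl
  take-suc-cong {suc ℓ} (p ∷ u) (q ∷ v) same du dv with refl , same′ ← ∷-injective same =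
    cong (p ∷_) (take-suc-cong u v same′ du dv)

  drop-length-++ : ∀ (u v : List B) → drop (length u) (u ++ v) ≡ v
  drop-length-++ []      v = refl
  drop-length-++ (_ ∷ u) v = drop-length-++ u v

  reverse-take : ∀ m (L : List B) → reverse (take m L) ≡ drop (length L ∸ m) (reverse L)
  reverse-take m L = sym (begin
    drop (length L ∸ m) (reverse L)
      ≡⟨ cong (drop (length L ∸ m) ∘ reverse) (take++drop≡id m L) ⟨
    drop (length L ∸ m) (reverse (take m L ++ drop m L))
      ≡⟨ cong (drop (length L ∸ m)) (reverse-++ (take m L) (drop m L)) ⟩
    drop (length L ∸ m) (reverse (drop m L) ++ reverse (take m L))
      ≡⟨ cong (λ z → drop z (reverse (drop m L) ++ reverse (take m L))) length-rest ⟩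
    drop (length (reverse (drop m L))) (reverse (drop m L) ++ reverse (take m L))
      ≡⟨ drop-length-++ (reverse (drop m L)) (reverse (take m L)) ⟩
    reverse (take m L)
      ∎)
    where
    open ≡-Reasoning
    length-rest : length L ∸ m ≡ length (reverse (drop m L))
    length-rest = sym (trans (length-reverse (drop m L)) (length-drop m L))

  remove : ∀ {y} (xs : List B) → y ∈ xs → List B
  remove (_ ∷ xs) (here _)  = xs
  remove (x ∷ xs) (there p) = x ∷ remove xs p

  length-remove : ∀ {y} (xs : List B) (p : y ∈ xs) → length xs ≡ suc (length (remove xs p))
  length-remove (_ ∷ xs) (here _)  = refl
  length-remove (_ ∷ xs) (there p) = cong suc (length-remove xs p)

  ∈-remove : ∀ {y z} (xs : List B) (p : y ∈ xs) → z ∈ xs → z ≢ y → z ∈ remove xs p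
  ∈-remove (_ ∷ xs) (here refl) (here refl) z≢y = ⊥-elim (z≢y refl)
  ∈-remove (_ ∷ xs) (here refl) (there q)   _   = q
  ∈-remove (_ ∷ xs) (there p)   (here refl) _   = here refl
  ∈-remove (_ ∷ xs) (there p)   (there q)   z≢y = there (∈-remove xs p q z≢y)

  distinct-⊆⇒length≤ : ∀ (ys xs : List B) → AllPairs _≢_ ys → All (_∈ xs) ys → length ys ≤ length xs
  distinct-⊆⇒length≤ []       xs _                  _              = z≤n
  distinct-⊆⇒length≤ (y ∷ ys) xs (y≢ys ∷ distinct) (y∈xs ∷ ys⊆xs) =
    subst (suc (length ys) ≤_) (sym (length-remove xs y∈xs))
          (s≤s (distinct-⊆⇒length≤ ys (remove xs y∈xs) distinct (still-in ys y≢ys ys⊆xs)))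
    where
    still-in : ∀ zs → All (y ≢_) zs → All (_∈ xs) zs → All (_∈ remove xs y∈xs) zs
    still-in []       []             []             = []
    still-in (z ∷ zs) (y≢z ∷ y≢zs) (z∈xs ∷ zs⊆xs) =
      ∈-remove xs y∈xs z∈xs (y≢z ∘ sym) ∷ still-in zs y≢zs zs⊆xs

nth-∈ : ∀ (xs : List ℕ) {i} → i < length xs → nth xs i ∈ xs
nth-∈ (x ∷ xs) {zero}  _         = here refl
nth-∈ (x ∷ xs) {suc i} (s≤s i<n) = there (nth-∈ xs i<n)

nth-mono : ∀ {xs : List ℕ} → AllPairs _<_ xs → ∀ {i j} → i ≤ j → j < length xs → nth xs i ≤ nth xs j
nth-mono {x ∷ xs} _            {zero}  {zero}  _         _         = ≤-refl
nth-mono {x ∷ xs} (x<xs ∷ _)   {zero}  {suc j} _         (s≤s j<n) = <⇒≤ (All.lookup x<xs (nth-∈ xs j<n))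
nth-mono {x ∷ xs} (_ ∷ sorted) {suc i} {suc j} (s≤s i≤j) (s≤s j<n) = nth-mono sorted i≤j j<n

module _ (f : ℕ → ℕ) where

  -- Chosen so that sum (map f (range lo hi)) is definitionally windowSum lo (suc hi ∸ lo).
  windowSum : ℕ → ℕ → ℕ
  windowSum lo n = sum (map f (map (lo +_) (upTo n)))

  windowSum-suc : ∀ lo n → windowSum lo (suc n) ≡ f lo + windowSum (suc lo) n
  windowSum-suc lo n = cong₂ (λ x xs → f x + sum (map f xs)) (+-identityʳ lo) shifted
    where
    shifted : map (lo +_) (applyUpTo suc n) ≡ map (suc lo +_) (upTo n)
    shifted = trans (map-applyUpTo suc (lo +_) n) (trans (sym (map-upTo _ n)) (map-cong (+-suc lo) (upTo n)))

  windowSum-mono : ∀ lo n lo′ n′ → lo′ ≤ lo → lo + n ≤ lo′ + n′ →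
                   windowSum lo n ≤ windowSum lo′ n′
  windowSum-mono lo zero    _   _        _     _    = z≤n
  windowSum-mono lo (suc n) lo′ zero     lo′≤lo ends =
    ⊥-elim (<⇒≱ (≤-<-trans lo′≤lo (m<m+n lo z<s)) (subst (lo + suc n ≤_) (+-identityʳ lo′) ends))
  windowSum-mono lo (suc n) lo′ (suc n′) lo′≤lo ends with m≤n⇒m<n∨m≡n lo′≤lo
  ... | inj₂ refl =
    subst₂ _≤_ (sym (windowSum-suc lo n)) (sym (windowSum-suc lo n′))
      (+-monoʳ-≤ (f lo) (windowSum-mono (suc lo) n (suc lo) n′ ≤-refl
                                        (subst₂ _≤_ (+-suc lo n) (+-suc lo n′) ends)))
  ... | inj₁ lo′<lo =
    subst (windowSum lo (suc n) ≤_) (sym (windowSum-suc lo′ n′))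
      (≤-trans (windowSum-mono lo (suc n) (suc lo′) n′ lo′<lo (subst (lo + suc n ≤_) (+-suc lo′ n′) ends))
               (m≤n+m _ (f lo′)))

JustAtMost JustAtLeast : Maybe ℕ → ℕ → Set
JustAtMost  m a = ∃[ r ] m ≡ just r × r ≤ a
JustAtLeast m a = ∃[ r ] m ≡ just r × a ≤ r

InIvl-intro : ∀ {lo hi a b′ c} → JustAtMost lo a → JustAtLeast hi b′ → a ≤ c → c ≤ b′ → InIvl lo hi c
InIvl-intro (_ , refl , r≤a) (_ , refl , b′≤r) a≤c c≤b′ = ≤-trans r≤a a≤c , ≤-trans c≤b′ b′≤r

module _ (p : ℕ → Bool) where

  firstSat-applyUpTo : ∀ (h : ℕ → ℕ) → (∀ {i j} → i ≤ j → h i ≤ h j) →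
                       ∀ {n i} → i < n → p (h i) ≡ true → JustAtMost (firstSat (applyUpTo h n) p) (h i)
  firstSat-applyUpTo h h-mono {suc n} {i} i<n p-hi with p (h 0) in p-h0
  ... | true = h 0 , refl , h-mono z≤n
  firstSat-applyUpTo h h-mono {suc n} {zero} i<n p-hi | false with () ← trans (sym p-h0) p-hi
  firstSat-applyUpTo h h-mono {suc n} {suc i} (s≤s i<n) p-hi | false =
    firstSat-applyUpTo (h ∘ suc) (h-mono ∘ s≤s) i<n p-hi

  firstSat-applyDownFrom : ∀ (h : ℕ → ℕ) → (∀ {i j} → i ≤ j → h i ≤ h j) →
                           ∀ {n i} → i < n → p (h i) ≡ true → JustAtLeast (firstSat (applyDownFrom h n) p) (h i)
  firstSat-applyDownFrom h h-mono {suc n} {i} (s≤s i≤n) p-hi with p (h n) in p-hn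
  ... | true = h n , refl , h-mono i≤n
  ... | false with m≤n⇒m<n∨m≡n i≤n
  ...   | inj₁ i<n = firstSat-applyDownFrom h h-mono i<n p-hi
  ...   | inj₂ refl with () ← trans (sym p-hn) p-hi

  private
    range-applyUpTo : ∀ lo hi → range lo hi ≡ applyUpTo (lo +_) (suc hi ∸ lo)
    range-applyUpTo lo hi = map-upTo (lo +_) (suc hi ∸ lo)

    index-in-range : ∀ {lo hi a} → lo ≤ a → a ≤ hi → a ∸ lo < suc hi ∸ lo
    index-in-range lo≤a a≤hi = ∸-monoˡ-< (s≤s a≤hi) lo≤a

    p-at-offset : ∀ {lo a} → lo ≤ a → p a ≡ true → p (lo + (a ∸ lo)) ≡ true
    p-at-offset lo≤a = subst (λ z → p z ≡ true) (sym (m+[n∸m]≡n lo≤a))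

  smallestIn-≤ : ∀ {lo hi a} → lo ≤ a → a ≤ hi → p a ≡ true → JustAtMost (smallestIn lo hi p) a
  smallestIn-≤ {lo} {hi} lo≤a a≤hi p-a =
    subst₂ (λ l x → JustAtMost (firstSat l p) x) (sym (range-applyUpTo lo hi)) (m+[n∸m]≡n lo≤a)
      (firstSat-applyUpTo (lo +_) (+-monoʳ-≤ lo) (index-in-range lo≤a a≤hi) (p-at-offset lo≤a p-a))

  largestIn-≥ : ∀ {lo hi a} → lo ≤ a → a ≤ hi → p a ≡ true → JustAtLeast (largestIn lo hi p) a
  largestIn-≥ {lo} {hi} lo≤a a≤hi p-a =
    subst₂ (λ l x → JustAtLeast (firstSat l p) x) (sym downFrom) (m+[n∸m]≡n lo≤a)
      (firstSat-applyDownFrom (lo +_) (+-monoʳ-≤ lo) (index-in-range lo≤a a≤hi) (p-at-offset lo≤a p-a))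
    where
    downFrom : reverse (range lo hi) ≡ applyDownFrom (lo +_) (suc hi ∸ lo)
    downFrom = trans (cong reverse (range-applyUpTo lo hi)) (reverse-applyUpTo (lo +_) (suc hi ∸ lo))

module LZ77 {A : Set} (_≟_ : DecidableEquality A) (X : List A) where

  EarlierOcc : ℕ → ℕ → Set
  EarlierOcc i ℓ = Σ ℕ λ t → t < i × take ℓ (drop t X) ≡ take ℓ (drop i X) × i + ℓ ≤ length X

  EarlierOcc-end : ∀ {i ℓ} → EarlierOcc i ℓ → i + ℓ ≤ length X
  EarlierOcc-end (_ , _ , _ , i+ℓ≤X) = i+ℓ≤X

  data Parse : ℕ → ℕ → Set where
    end    : Parse (length X) 0
    single : ∀ {i k} → i < length X → Parse (suc i) k → Parse i (suc k)
    copy   : ∀ {i ℓ k} → 1 ≤ ℓ → EarlierOcc i ℓ → Parse (i + ℓ) k → Parse i (suc k)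

  earlierOcc-complete : ∀ {i ℓ} → EarlierOcc i ℓ → earlierOcc _≟_ X i ℓ ≡ true
  earlierOcc-complete {i} {ℓ} (t , t<i , same , i+ℓ≤) =
    any-applyUpTo (λ j → matchAt _≟_ X j i ℓ) id t<i matches
    where
    matches : matchAt _≟_ X t i ℓ ≡ true
    matches with ≡-dec _≟_ (take ℓ (drop t X)) (take ℓ (drop i X))
    ... | yes _ = ≤⇒≤ᵇ≡true i+ℓ≤
    ... | no ≢  = ⊥-elim (≢ same)

  longestDown-maximal : ∀ {i ℓ} l → ℓ ≤ l → earlierOcc _≟_ X i ℓ ≡ true →
                        ℓ ≤ longestDown _≟_ X i l
  longestDown-maximal zero z≤n _ = z≤n
  longestDown-maximal {i} {ℓ} (suc l) ℓ≤ occ with earlierOcc _≟_ X i (suc l) in occ-l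
  ... | true  = ℓ≤
  ... | false with m≤n⇒m<n∨m≡n ℓ≤
  ...   | inj₁ (s≤s ℓ≤l) = longestDown-maximal l ℓ≤l occ
  ...   | inj₂ refl with () ← trans (sym occ-l) occ

  longestDown≤phraseLen : ∀ i → longestDown _≟_ X i (length X ∸ i) ≤ phraseLen _≟_ X i
  longestDown≤phraseLen i with longestDown _≟_ X i (length X ∸ i)
  ... | zero  = z≤n
  ... | suc _ = ≤-refl

  phraseLen-pos : ∀ i → 1 ≤ phraseLen _≟_ X i
  phraseLen-pos i with longestDown _≟_ X i (length X ∸ i)
  ... | zero  = ≤-refl
  ... | suc _ = s≤s z≤n

  EarlierOcc-suffix : ∀ {i ℓ} d → d ≤ ℓ → EarlierOcc i ℓ → EarlierOcc (i + d) (ℓ ∸ d)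
  EarlierOcc-suffix {i} {ℓ} d d≤ℓ (t , t<i , same , i+ℓ≤) =
    t + d , +-monoˡ-< d t<i , same-suffix , subst (_≤ length X) (sym end-same) i+ℓ≤
    where
    open ≡-Reasoning
    take-drop′ : ∀ (L : List A) → take (ℓ ∸ d) (drop d L) ≡ drop d (take ℓ L)
    take-drop′ L = trans (take-drop (ℓ ∸ d) d L) (cong (λ z → drop d (take z L)) (m+[n∸m]≡n d≤ℓ))
    same-suffix : take (ℓ ∸ d) (drop (t + d) X) ≡ take (ℓ ∸ d) (drop (i + d) X)
    same-suffix = begin
      take (ℓ ∸ d) (drop (t + d) X)    ≡⟨ cong (take (ℓ ∸ d)) (drop-drop t d X) ⟨
      take (ℓ ∸ d) (drop d (drop t X)) ≡⟨ take-drop′ (drop t X) ⟩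
      drop d (take ℓ (drop t X))       ≡⟨ cong (drop d) same ⟩
      drop d (take ℓ (drop i X))       ≡⟨ take-drop′ (drop i X) ⟨
      take (ℓ ∸ d) (drop d (drop i X)) ≡⟨ cong (take (ℓ ∸ d)) (drop-drop i d X) ⟩
      take (ℓ ∸ d) (drop (i + d) X)    ∎
    end-same : i + d + (ℓ ∸ d) ≡ i + ℓ
    end-same = trans (+-assoc i d (ℓ ∸ d)) (cong (i +_) (m+[n∸m]≡n d≤ℓ))

  phrase-reaches : ∀ {i ℓ i′} → EarlierOcc i ℓ → i ≤ i′ → i′ < i + ℓ →
                   i + ℓ ≤ i′ + phraseLen _≟_ X i′
  phrase-reaches {i} {ℓ} {i′} occ i≤i′ i′<i+ℓ =
    subst (_≤ i′ + phraseLen _≟_ X i′) ends-same (+-monoʳ-≤ i′ rest≤phrase)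
    where
    d = i′ ∸ i
    i+d≡i′ : i + d ≡ i′
    i+d≡i′ = m+[n∸m]≡n i≤i′
    d≤ℓ : d ≤ ℓ
    d≤ℓ = +-cancelˡ-≤ i d ℓ (subst (_≤ i + ℓ) (sym i+d≡i′) (<⇒≤ i′<i+ℓ))
    occ′ : EarlierOcc i′ (ℓ ∸ d)
    occ′ = subst (λ z → EarlierOcc z (ℓ ∸ d)) i+d≡i′ (EarlierOcc-suffix d d≤ℓ occ)
    rest≤room : ℓ ∸ d ≤ length X ∸ i′
    rest≤room = subst (_≤ length X ∸ i′) (m+n∸m≡n i′ (ℓ ∸ d)) (∸-monoˡ-≤ i′ (EarlierOcc-end occ′))
    rest≤phrase : ℓ ∸ d ≤ phraseLen _≟_ X i′
    rest≤phrase = ≤-trans (longestDown-maximal (length X ∸ i′) rest≤room (earlierOcc-complete occ′))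
                          (longestDown≤phraseLen i′)
    ends-same : i′ + (ℓ ∸ d) ≡ i + ℓ
    ends-same = trans (cong (_+ (ℓ ∸ d)) (sym i+d≡i′))
                      (trans (+-assoc i d (ℓ ∸ d)) (cong (i +_) (m+[n∸m]≡n d≤ℓ)))

  -- Greedy stays ahead: a greedy phrase starting inside a phrase of the given parse reaches at
  -- least the end of that phrase (phrase-reaches).
  lzFrom-optimal : ∀ {i k} → Parse i k → ∀ fuel i′ → i ≤ i′ → lzFrom _≟_ X fuel i′ ≤ k
  lzFrom-optimal _ zero i′ _ = z≤n
  lzFrom-optimal end (suc fuel) i′ X≤i′ with i′ <ᵇ length X in i′<X
  ... | true  = ⊥-elim (<⇒≱ (<ᵇ⇒< i′ (length X) (Equivalence.from T-≡ i′<X)) X≤i′)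
  ... | false = z≤n
  lzFrom-optimal {i} (single i<X parse) (suc fuel) i′ i≤i′ with m≤n⇒m<n∨m≡n i≤i′
  ... | inj₁ i<i′ = m≤n⇒m≤1+n (lzFrom-optimal parse (suc fuel) i′ i<i′)
  ... | inj₂ refl rewrite <⇒<ᵇ≡true i<X =
        s≤s (lzFrom-optimal parse fuel (i + phraseLen _≟_ X i)
               (subst (_≤ i + phraseLen _≟_ X i) (+-comm i 1) (+-monoʳ-≤ i (phraseLen-pos i))))
  lzFrom-optimal {i} (copy {ℓ = ℓ} _ occ parse) (suc fuel) i′ i≤i′ with i + ℓ ≤? i′
  ... | yes i+ℓ≤i′ = m≤n⇒m≤1+n (lzFrom-optimal parse (suc fuel) i′ i+ℓ≤i′)
  ... | no i+ℓ≰i′ rewrite <⇒<ᵇ≡true (<-≤-trans (≰⇒> i+ℓ≰i′) (EarlierOcc-end occ)) =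
        s≤s (lzFrom-optimal parse fuel (i′ + phraseLen _≟_ X i′)
                            (phrase-reaches occ i≤i′ (≰⇒> i+ℓ≰i′)))

  lzSize-optimal : ∀ {k} → Parse 0 k → lzSize _≟_ X ≤ k
  lzSize-optimal parse = lzFrom-optimal parse (length X) 0 z≤n

module SelfAlignmentParse {A : Set} (_≟_ : DecidableEquality A) (X : List A) where
  open LZ77 _≟_ X

  ParseWithin : ℕ → ℕ → Set
  ParseWithin i C = ∃[ k ] Parse i k × k ≤ C

  within-mono : ∀ {i C C′} → ParseWithin i C → C ≤ C′ → ParseWithin i C′
  within-mono (k , parse , k≤C) C≤C′ = k , parse , ≤-trans k≤C C≤C′

  within-single : ∀ {i C} → i < length X → ParseWithin (suc i) C → ParseWithin i (suc C)
  within-single i<X (k , parse , k≤C) = suc k , single i<X parse , s≤s k≤C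

  -- The pending phrase X[s..x) is a copy of X[t..y) for some t < s.
  Run : ℕ → ℕ → ℕ → Set
  Run s x y = Σ ℕ λ ℓ → s + ℓ ≡ x × Σ ℕ λ t → t + ℓ ≡ y × t < s ×
                take ℓ (drop t X) ≡ take ℓ (drop s X)

  run-start : ∀ {x y} → y < x → Run x x y
  run-start {x} {y} y<x = 0 , +-identityʳ x , y , +-identityʳ y , y<x , refl

  run-source< : ∀ {s x y} → Run s x y → y < x
  run-source< (ℓ , refl , t , refl , t<s , _) = +-monoˡ-< ℓ t<s

  run-extend : ∀ {s x y a xs ys} → Run s x y → drop x X ≡ a ∷ xs → drop y X ≡ a ∷ ys →
               Run s (suc x) (suc y)
  run-extend {s} (ℓ , refl , t , refl , t<s , same) at-x at-y =
    suc ℓ , +-suc s ℓ , t , +-suc t ℓ , t<s ,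
    take-suc-cong (drop t X) (drop s X) same (trans (drop-drop t ℓ X) at-y) (trans (drop-drop s ℓ X) at-x)

  run-close : ∀ {s x y C} → Run s x y → x ≤ length X → ParseWithin x C → ParseWithin s (suc C)
  run-close (zero , s+0≡x , _) _ (k , parse , k≤C) =
    k , subst (λ z → Parse z k) (trans (sym s+0≡x) (+-identityʳ _)) parse , m≤n⇒m≤1+n k≤C
  run-close (suc ℓ , refl , t , refl , t<s , same) x≤X (k , parse , k≤C) =
    suc k , copy (s≤s z≤n) (t , t<s , same , x≤X) parse , s≤s k≤C

  private
    2+2c≡2[1+c] : ∀ c → suc (suc (2 * c)) ≡ 2 * suc c
    2+2c≡2[1+c] c = sym (*-distribˡ-+ 2 1 c)

    edit-close-single : ∀ c → suc (suc (2 * c + 1)) ≤ 2 * suc c + 1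
    edit-close-single c = ≤-reflexive (cong (_+ 1) (2+2c≡2[1+c] c))

    edit-close : ∀ c → suc (2 * c + 1) ≤ 2 * suc c + 1
    edit-close c = ≤-trans (n≤1+n _) (edit-close-single c)

    edit-close-diagonal : ∀ c → suc (2 * c) ≤ 2 * suc c + 1
    edit-close-diagonal c = ≤-trans (s≤s (m≤m+n (2 * c) 1)) (edit-close c)

    edit-leave-diagonal : ∀ c → suc (2 * c + 1) ≤ 2 * suc c
    edit-leave-diagonal c = ≤-reflexive (trans (cong suc (+-comm (2 * c) 1)) (2+2c≡2[1+c] c))

  run-close-single : ∀ {s x y C} → Run s x y → x < length X → ParseWithin (suc x) C →
                     ParseWithin s (suc (suc C))
  run-close-single run x<X parse = run-close run (<⇒≤ x<X) (within-single x<X parse)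

  -- Each edit operation closes the pending phrase and contributes at most one single-character
  -- phrase; matches off the diagonal extend the pending phrase, whose source lies to the left.
  mutual
    parseBelow : ∀ {s x y st c xs ys} → Run s x y → x ≤ length X → drop x X ≡ xs → drop y X ≡ ys →
                 Al _≟_ xs ys st c → NoSelf _≟_ x y st → ParseWithin s (2 * c + 1)
    parseBelow {y = y} run x≤X _ at-y al-nil _ =
      ⊥-elim (<⇒≱ (<-≤-trans (run-source< run) x≤X) (drop-[]⇒length≤ y X at-y))
    parseBelow {x = x} {y} run _ at-x at-y (al-diag {x = a} {b} {c = c} al) (ns-diag _ ns) with a ≟ b
    ... | yes refl =
      parseBelow (run-extend run at-x at-y) (drop-∷⇒< x X at-x)
                 (drop-∷⇒drop-suc x X at-x) (drop-∷⇒drop-suc y X at-y) al ns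
    ... | no _ =
      within-mono (run-close-single run (drop-∷⇒< x X at-x)
                    (parseBelow (run-start (s≤s (run-source< run))) (drop-∷⇒< x X at-x)
                                (drop-∷⇒drop-suc x X at-x) (drop-∷⇒drop-suc y X at-y) al ns))
                  (edit-close-single c)
    parseBelow {x = x} run _ at-x at-y (al-del {c = c} al) (ns-del ns) =
      within-mono (run-close-single run (drop-∷⇒< x X at-x)
                    (parseBelow (run-start (m<n⇒m<1+n (run-source< run))) (drop-∷⇒< x X at-x)
                                (drop-∷⇒drop-suc x X at-x) at-y al ns))
                  (edit-close-single c)
    parseBelow {y = y} run x≤X at-x at-y (al-ins {c = c} al) (ns-ins ns) with m≤n⇒m<n∨m≡n (run-source< run)
    ... | inj₁ 1+y<x =
      within-mono (run-close run x≤X (parseBelow (run-start 1+y<x) x≤X at-x (drop-∷⇒drop-suc y X at-y) al ns))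
                  (edit-close c)
    ... | inj₂ refl =
      within-mono (run-close run x≤X (parseOnDiagonal x≤X at-x (drop-∷⇒drop-suc y X at-y) al ns))
                  (edit-close-diagonal c)

    parseAbove : ∀ {s x y st c xs ys} → Run s y x → y ≤ length X → drop x X ≡ xs → drop y X ≡ ys →
                 Al _≟_ xs ys st c → NoSelf _≟_ x y st → ParseWithin s (2 * c + 1)
    parseAbove {x = x} run y≤X at-x _ al-nil _ =
      ⊥-elim (<⇒≱ (<-≤-trans (run-source< run) y≤X) (drop-[]⇒length≤ x X at-x))
    parseAbove {x = x} {y} run _ at-x at-y (al-diag {x = a} {b} {c = c} al) (ns-diag _ ns) with a ≟ b
    ... | yes refl =
      parseAbove (run-extend run at-y at-x) (drop-∷⇒< y X at-y)
                 (drop-∷⇒drop-suc x X at-x) (drop-∷⇒drop-suc y X at-y) al ns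
    ... | no _ =
      within-mono (run-close-single run (drop-∷⇒< y X at-y)
                    (parseAbove (run-start (s≤s (run-source< run))) (drop-∷⇒< y X at-y)
                                (drop-∷⇒drop-suc x X at-x) (drop-∷⇒drop-suc y X at-y) al ns))
                  (edit-close-single c)
    parseAbove {y = y} run _ at-x at-y (al-ins {c = c} al) (ns-ins ns) =
      within-mono (run-close-single run (drop-∷⇒< y X at-y)
                    (parseAbove (run-start (m<n⇒m<1+n (run-source< run))) (drop-∷⇒< y X at-y)
                                at-x (drop-∷⇒drop-suc y X at-y) al ns))
                  (edit-close-single c)
    parseAbove {x = x} run y≤X at-x at-y (al-del {c = c} al) (ns-del ns) with m≤n⇒m<n∨m≡n (run-source< run)
    ... | inj₁ 1+x<y =
      within-mono (run-close run y≤X (parseAbove (run-start 1+x<y) y≤X (drop-∷⇒drop-suc x X at-x) at-y al ns))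
                  (edit-close c)
    ... | inj₂ refl =
      within-mono (run-close run y≤X (parseOnDiagonal y≤X (drop-∷⇒drop-suc x X at-x) at-y al ns))
                  (edit-close-diagonal c)

    parseOnDiagonal : ∀ {x st c xs ys} → x ≤ length X → drop x X ≡ xs → drop x X ≡ ys →
                      Al _≟_ xs ys st c → NoSelf _≟_ x x st → ParseWithin x (2 * c)
    parseOnDiagonal {x} x≤X at-x _ al-nil _ =
      0 , subst (λ z → Parse z 0) (≤-antisym (drop-[]⇒length≤ x X at-x) x≤X) end , z≤n
    parseOnDiagonal _ _ _ (al-diag _) (ns-diag x≢x _) = ⊥-elim (x≢x refl)
    parseOnDiagonal {x} _ at-x at-y (al-del {c = c} al) (ns-del ns) =
      within-mono (within-single (drop-∷⇒< x X at-x)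
                    (parseBelow (run-start ≤-refl) (drop-∷⇒< x X at-x) (drop-∷⇒drop-suc x X at-x) at-y al ns))
                  (edit-leave-diagonal c)
    parseOnDiagonal {x} _ at-x at-y (al-ins {c = c} al) (ns-ins ns) =
      within-mono (within-single (drop-∷⇒< x X at-y)
                    (parseAbove (run-start ≤-refl) (drop-∷⇒< x X at-y) at-x (drop-∷⇒drop-suc x X at-y) al ns))
                  (edit-leave-diagonal c)

  lzSize≤2*selfed : ∀ {d} → SelfedLE _≟_ X d → lzSize _≟_ X ≤ 2 * d
  lzSize≤2*selfed (st , c , al , ns , c≤d) =
    let (k , parse , k≤2c) = parseOnDiagonal z≤n refl refl al ns
    in ≤-trans (lzSize-optimal parse) (≤-trans k≤2c (*-monoʳ-≤ 2 c≤d))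

lenˣ lenʸ : List Step → ℕ
lenˣ []          = 0
lenˣ (diag ∷ st) = suc (lenˣ st)
lenˣ (del ∷ st)  = suc (lenˣ st)
lenˣ (ins ∷ st)  = lenˣ st
lenʸ []          = 0
lenʸ (diag ∷ st) = suc (lenʸ st)
lenʸ (del ∷ st)  = lenʸ st
lenʸ (ins ∷ st)  = suc (lenʸ st)

lenˣ-++ : ∀ u v → lenˣ (u ++ v) ≡ lenˣ u + lenˣ v
lenˣ-++ []          v = refl
lenˣ-++ (diag ∷ u)  v = cong suc (lenˣ-++ u v)
lenˣ-++ (del ∷ u)   v = cong suc (lenˣ-++ u v)
lenˣ-++ (ins ∷ u)   v = lenˣ-++ u v

lenʸ-++ : ∀ u v → lenʸ (u ++ v) ≡ lenʸ u + lenʸ v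
lenʸ-++ []          v = refl
lenʸ-++ (diag ∷ u)  v = cong suc (lenʸ-++ u v)
lenʸ-++ (del ∷ u)   v = lenʸ-++ u v
lenʸ-++ (ins ∷ u)   v = cong suc (lenʸ-++ u v)

lenˣ-reverse : ∀ st → lenˣ (reverse st) ≡ lenˣ st
lenˣ-reverse []       = refl
lenˣ-reverse (s ∷ st)
  rewrite unfold-reverse s st | lenˣ-++ (reverse st) [ s ] | lenˣ-reverse st =
  trans (+-comm (lenˣ st) (lenˣ [ s ])) (sym (lenˣ-++ [ s ] st))

lenʸ-reverse : ∀ st → lenʸ (reverse st) ≡ lenʸ st
lenʸ-reverse []       = refl
lenʸ-reverse (s ∷ st)
  rewrite unfold-reverse s st | lenʸ-++ (reverse st) [ s ] | lenʸ-reverse st =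
  trans (+-comm (lenʸ st) (lenʸ [ s ])) (sym (lenʸ-++ [ s ] st))

module Alignments {A : Set} (_≟_ : DecidableEquality A) where

  Al-length : ∀ {X Y st c} → Al _≟_ X Y st c → lenˣ st ≡ length X × lenʸ st ≡ length Y
  Al-length al-nil       = refl , refl
  Al-length (al-diag al) = cong suc (proj₁ (Al-length al)) , cong suc (proj₂ (Al-length al))
  Al-length (al-del al)  = cong suc (proj₁ (Al-length al)) , proj₂ (Al-length al)
  Al-length (al-ins al)  = proj₁ (Al-length al) , cong suc (proj₂ (Al-length al))

  Al-++ : ∀ {X Y st c X′ Y′ st′ c′} → Al _≟_ X Y st c → Al _≟_ X′ Y′ st′ c′ →
          Al _≟_ (X ++ X′) (Y ++ Y′) (st ++ st′) (c + c′)
  Al-++ al-nil al′ = al′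
  Al-++ {c′ = c′} (al-diag {x = x} {y} {c = c} al) al′ =
    subst (Al _≟_ _ _ _) (sym (+-assoc (mis _≟_ x y) c c′)) (al-diag (Al-++ al al′))
  Al-++ (al-del al) al′ = al-del (Al-++ al al′)
  Al-++ (al-ins al) al′ = al-ins (Al-++ al al′)

  Al-reverse : ∀ {X Y st c} → Al _≟_ X Y st c → Al _≟_ (reverse X) (reverse Y) (reverse st) c
  Al-reverse al-nil = al-nil
  Al-reverse (al-diag {x} {y} {xs} {ys} {st} {c} al)
    rewrite unfold-reverse x xs | unfold-reverse y ys | unfold-reverse diag st =
    subst (Al _≟_ (reverse xs ++ [ x ]) (reverse ys ++ [ y ]) (reverse st ++ [ diag ]))
          (trans (cong (c +_) (+-identityʳ (mis _≟_ x y))) (+-comm c (mis _≟_ x y)))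
          (Al-++ (Al-reverse al) (al-diag al-nil))
  Al-reverse (al-del {x} {xs} {ys} {st} {c} al) rewrite unfold-reverse x xs | unfold-reverse del st =
    subst₂ (λ Y c′ → Al _≟_ (reverse xs ++ [ x ]) Y (reverse st ++ [ del ]) c′)
           (++-identityʳ (reverse ys)) (+-comm c 1)
           (Al-++ (Al-reverse al) (al-del al-nil))
  Al-reverse (al-ins {y} {xs} {ys} {st} {c} al) rewrite unfold-reverse y ys | unfold-reverse ins st =
    subst₂ (λ X c′ → Al _≟_ X (reverse ys ++ [ y ]) (reverse st ++ [ ins ]) c′)
           (++-identityʳ (reverse xs)) (+-comm c 1)
           (Al-++ (Al-reverse al) (al-ins al-nil))

  NoSelf-++ : ∀ {x y u v} → NoSelf _≟_ x y u → NoSelf _≟_ (x + lenˣ u) (y + lenʸ u) v →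
              NoSelf _≟_ x y (u ++ v)
  NoSelf-++ {x} {y} {v = v} ns-nil nv =
    subst₂ (λ x′ y′ → NoSelf _≟_ x′ y′ v) (+-identityʳ x) (+-identityʳ y) nv
  NoSelf-++ {x} {y} {diag ∷ u} {v} (ns-diag x≢y nu) nv =
    ns-diag x≢y (NoSelf-++ nu (subst₂ (λ x′ y′ → NoSelf _≟_ x′ y′ v)
                                      (+-suc x (lenˣ u)) (+-suc y (lenʸ u)) nv))
  NoSelf-++ {x} {y} {del ∷ u} {v} (ns-del nu) nv =
    ns-del (NoSelf-++ nu (subst (λ x′ → NoSelf _≟_ x′ (y + lenʸ u) v) (+-suc x (lenˣ u)) nv))
  NoSelf-++ {x} {y} {ins ∷ u} {v} (ns-ins nu) nv =
    ns-ins (NoSelf-++ nu (subst (λ y′ → NoSelf _≟_ (x + lenˣ u) y′ v) (+-suc y (lenʸ u)) nv))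

  -- Reversal sends the point (x + i , y + j) of the path to (x′ + lenˣ st - i , y′ + lenʸ st - j);
  -- the hypothesis makes this reflection preserve the diagonal.
  NoSelf-reverse : ∀ {x y st} → NoSelf _≟_ x y st →
                   ∀ x′ y′ → x′ + (x + lenˣ st) ≡ y′ + (y + lenʸ st) → NoSelf _≟_ x′ y′ (reverse st)
  NoSelf-reverse ns-nil _ _ _ = ns-nil
  NoSelf-reverse {x} {y} (ns-diag {st = st} x≢y ns) x′ y′ ends rewrite unfold-reverse diag st =
    NoSelf-++ (NoSelf-reverse ns x′ y′ ends′) (ns-diag last≢ ns-nil)
    where
    ends′ : x′ + (suc x + lenˣ st) ≡ y′ + (suc y + lenʸ st)
    ends′ = trans (cong (x′ +_) (sym (+-suc x (lenˣ st))))
                  (trans ends (cong (y′ +_) (+-suc y (lenʸ st))))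
    last≢ : x′ + lenˣ (reverse st) ≢ y′ + lenʸ (reverse st)
    last≢ eq rewrite lenˣ-reverse st | lenʸ-reverse st =
      x≢y (suc-injective (+-cancelˡ-≡ (x′ + lenˣ st) (suc x) (suc y) (begin
        x′ + lenˣ st + suc x   ≡⟨ +-assoc x′ (lenˣ st) (suc x) ⟩
        x′ + (lenˣ st + suc x) ≡⟨ cong (x′ +_) (+-comm (lenˣ st) (suc x)) ⟩
        x′ + (suc x + lenˣ st) ≡⟨ ends′ ⟩
        y′ + (suc y + lenʸ st) ≡⟨ cong (y′ +_) (+-comm (suc y) (lenʸ st)) ⟩
        y′ + (lenʸ st + suc y) ≡⟨ +-assoc y′ (lenʸ st) (suc y) ⟨
        y′ + lenʸ st + suc y   ≡⟨ cong (_+ suc y) eq ⟨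
        x′ + lenˣ st + suc y   ∎)))
      where open ≡-Reasoning
  NoSelf-reverse {x} (ns-del {st = st} ns) x′ y′ ends rewrite unfold-reverse del st =
    NoSelf-++ (NoSelf-reverse ns x′ y′ (trans (cong (x′ +_) (sym (+-suc x (lenˣ st)))) ends)) (ns-del ns-nil)
  NoSelf-reverse {y = y} (ns-ins {st = st} ns) x′ y′ ends rewrite unfold-reverse ins st =
    NoSelf-++ (NoSelf-reverse ns x′ y′ (trans ends (cong (y′ +_) (+-suc y (lenʸ st))))) (ns-ins ns-nil)

  NoSelf-unshift : ∀ q {x y st} → NoSelf _≟_ (x + q) (y + q) st → NoSelf _≟_ x y st
  NoSelf-unshift q ns-nil              = ns-nil
  NoSelf-unshift q (ns-diag x+q≢y+q ns) = ns-diag (x+q≢y+q ∘ cong (_+ q)) (NoSelf-unshift q ns)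
  NoSelf-unshift q (ns-del ns)          = ns-del (NoSelf-unshift q ns)
  NoSelf-unshift q (ns-ins ns)          = ns-ins (NoSelf-unshift q ns)

  selfed-reverse : ∀ {X d} → SelfedLE _≟_ X d → SelfedLE _≟_ (reverse X) d
  selfed-reverse (st , c , al , ns , c≤d) =
    reverse st , c , Al-reverse al ,
    NoSelf-reverse ns 0 0 (trans (proj₁ (Al-length al)) (sym (proj₂ (Al-length al)))) , c≤d

  selfed-nonempty : ∀ {a X d} → SelfedLE _≟_ (a ∷ X) d → 1 ≤ d
  selfed-nonempty (_ , _ , al-diag _ , ns-diag 0≢0 _ , _) = ⊥-elim (0≢0 refl)
  selfed-nonempty (_ , _ , al-del _ , _ , c≤d) = ≤-trans (s≤s z≤n) c≤d
  selfed-nonempty (_ , _ , al-ins _ , _ , c≤d) = ≤-trans (s≤s z≤n) c≤d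

  module _ (X : List A) where

    SelfAlignedWithin : ℕ → ℕ → Set
    SelfAlignedWithin p C = ∃[ st ] ∃[ c ] Al _≟_ (drop p X) (drop p X) st c × NoSelf _≟_ p p st × c ≤ C

    private
      pad-cost : ∀ c {x y} → x ≤ y → suc c + (y ∸ x) ≡ c + (suc y ∸ x)
      pad-cost c {x} {y} x≤y = trans (sym (+-suc c (y ∸ x))) (cong (c +_) (sym (+-∸-assoc 1 x≤y)))

    pad-insertions : ∀ {x y st c} → x ≤ y → y ≤ length X → Al _≟_ (drop x X) (drop y X) st c →
                     NoSelf _≟_ x y st → SelfAlignedWithin x (c + (y ∸ x))
    pad-insertions {x} {y} {st} {c} x≤y y≤X al ns with m≤n⇒m<n∨m≡n x≤y
    ... | inj₂ refl = st , c , al , ns , m≤m+n c (y ∸ y)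
    pad-insertions {x} {suc y} {st} {c} x≤y y≤X al ns | inj₁ (s≤s x≤y′) =
      let (a , y-split) = drop-∷-drop-suc X y≤X
          (st′ , c′ , al′ , ns′ , c′≤) = pad-insertions x≤y′ (<⇒≤ y≤X)
            (subst (λ Y → Al _≟_ (drop x X) Y (ins ∷ st) (suc c)) (sym y-split) (al-ins al)) (ns-ins ns)
      in st′ , c′ , al′ , ns′ , ≤-trans c′≤ (≤-reflexive (pad-cost c x≤y′))

    pad-deletions : ∀ {x y st c} → y ≤ x → x ≤ length X → Al _≟_ (drop x X) (drop y X) st c →
                    NoSelf _≟_ x y st → SelfAlignedWithin y (c + (x ∸ y))
    pad-deletions {x} {y} {st} {c} y≤x x≤X al ns with m≤n⇒m<n∨m≡n y≤x
    ... | inj₂ refl = st , c , al , ns , m≤m+n c (x ∸ x)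
    pad-deletions {suc x} {y} {st} {c} y≤x x≤X al ns | inj₁ (s≤s y≤x′) =
      let (a , x-split) = drop-∷-drop-suc X x≤X
          (st′ , c′ , al′ , ns′ , c′≤) = pad-deletions y≤x′ (<⇒≤ x≤X)
            (subst (λ X′ → Al _≟_ X′ (drop y X) (del ∷ st) (suc c)) (sym x-split) (al-del al)) (ns-del ns)
      in st′ , c′ , al′ , ns′ , ≤-trans c′≤ (≤-reflexive (pad-cost c y≤x′))

    SelfAlignedWithin-mono : ∀ {p C C′} → SelfAlignedWithin p C → C ≤ C′ → SelfAlignedWithin p C′
    SelfAlignedWithin-mono (st , c , al , ns , c≤C) C≤C′ = st , c , al , ns , ≤-trans c≤C C≤C′

    -- Follow the path until it has entered both X[p..) and its copy; the cost of the rest, plus the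
    -- |x - y| padding steps, is bounded by the invariant c + |x - y|.
    module _ (p : ℕ) (p≤X : p ≤ length X) where
      mutual
        walk : ∀ {x y st c xs ys} → x ≤ length X → y ≤ length X → x ≤ p ⊎ y ≤ p →
               drop x X ≡ xs → drop y X ≡ ys → Al _≟_ xs ys st c → NoSelf _≟_ x y st →
               SelfAlignedWithin p (c + ∣ x - y ∣)
        walk {x} {y} {st} {c} x≤X y≤X x≤p⊎y≤p refl refl al ns with p ≤? x | p ≤? y | x≤p⊎y≤p
        ... | yes p≤x | yes p≤y | inj₁ x≤p with refl ← ≤-antisym x≤p p≤x =
          SelfAlignedWithin-mono (pad-insertions p≤y y≤X al ns)
                                 (≤-reflexive (cong (c +_) (sym (m≤n⇒∣m-n∣≡n∸m p≤y))))
        ... | yes p≤x | yes p≤y | inj₂ y≤p with refl ← ≤-antisym y≤p p≤y =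
          SelfAlignedWithin-mono (pad-deletions p≤x x≤X al ns)
                                 (≤-reflexive (cong (c +_) (sym (m≤n⇒∣n-m∣≡n∸m p≤x))))
        ... | no p≰x | _ | _ = step x≤X y≤X (inj₁ (≰⇒> p≰x)) refl refl al ns
        ... | yes _ | no p≰y | _ = step x≤X y≤X (inj₂ (≰⇒> p≰y)) refl refl al ns

        step : ∀ {x y st c xs ys} → x ≤ length X → y ≤ length X → x < p ⊎ y < p →
               drop x X ≡ xs → drop y X ≡ ys → Al _≟_ xs ys st c → NoSelf _≟_ x y st →
               SelfAlignedWithin p (c + ∣ x - y ∣)
        step {x} _ _ (inj₁ x<p) at-x _ al-nil _ =
          ⊥-elim (<⇒≱ x<p (≤-trans p≤X (drop-[]⇒length≤ x X at-x)))
        step {y = y} _ _ (inj₂ y<p) _ at-y al-nil _ =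
          ⊥-elim (<⇒≱ y<p (≤-trans p≤X (drop-[]⇒length≤ y X at-y)))
        step {x} {y} _ _ x<p⊎y<p at-x at-y (al-diag {x = a} {b} {c = c} al) (ns-diag _ ns) =
          SelfAlignedWithin-mono
            (walk (drop-∷⇒< x X at-x) (drop-∷⇒< y X at-y) x<p⊎y<p
                  (drop-∷⇒drop-suc x X at-x) (drop-∷⇒drop-suc y X at-y) al ns)
            (+-monoˡ-≤ ∣ x - y ∣ (m≤n+m c (mis _≟_ a b)))
        step {x} {y} _ y≤X x<p⊎y<p at-x at-y (al-del {c = c} al) (ns-del ns) =
          SelfAlignedWithin-mono
            (walk (drop-∷⇒< x X at-x) y≤X (map₂ <⇒≤ x<p⊎y<p) (drop-∷⇒drop-suc x X at-x) at-y al ns)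
            (≤-trans (+-monoʳ-≤ c (∣1+m-n∣≤1+∣m-n∣ x y)) (≤-reflexive (+-suc c ∣ x - y ∣)))
        step {x} {y} x≤X _ x<p⊎y<p at-x at-y (al-ins {c = c} al) (ns-ins ns) =
          SelfAlignedWithin-mono
            (walk x≤X (drop-∷⇒< y X at-y) (map₁ <⇒≤ x<p⊎y<p) at-x (drop-∷⇒drop-suc y X at-y) al ns)
            (≤-trans (+-monoʳ-≤ c (∣m-1+n∣≤1+∣m-n∣ x y)) (≤-reflexive (+-suc c ∣ x - y ∣)))

  selfed-drop : ∀ {X d} p → SelfedLE _≟_ X d → SelfedLE _≟_ (drop p X) d
  selfed-drop {X} {d} p (st , c , al , ns , c≤d) with p ≤? length X
  ... | no p≰X rewrite drop-all p X (<⇒≤ (≰⇒> p≰X)) = [] , 0 , al-nil , ns-nil , z≤n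
  ... | yes p≤X =
    let (st′ , c′ , al′ , ns′ , c′≤) = walk X p p≤X z≤n z≤n (inj₁ z≤n) refl refl al ns
    in st′ , c′ , al′ , NoSelf-unshift p ns′ , ≤-trans c′≤ (≤-trans (≤-reflexive (+-identityʳ c)) c≤d)

module Windows {A : Set} (_≟_ : DecidableEquality A) where
  open Alignments _≟_
  open SelfAlignmentParse _≟_ using (lzSize≤2*selfed)

  sub-take : ∀ (X : List A) {i j k} → j ≤ k → sub _≟_ X i j ≡ take (j ∸ i) (sub _≟_ X i k)
  sub-take X {i} {j} {k} j≤k = sym (trans (take-take (j ∸ i) (k ∸ i) (drop i X))
                                          (cong (λ z → take z (drop i X)) (m≤n⇒m⊓n≡m (∸-monoˡ-≤ i j≤k))))

  sub-drop : ∀ (X : List A) {i j k} → i ≤ j → j ≤ k → sub _≟_ X j k ≡ drop (j ∸ i) (sub _≟_ X i k)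
  sub-drop X {i} {j} {k} i≤j j≤k = sym (begin
    drop d (take (k ∸ i) (drop i X))          ≡⟨ cong (λ z → drop d (take z (drop i X))) (m+[n∸m]≡n d≤) ⟨
    drop d (take (d + (k ∸ i ∸ d)) (drop i X)) ≡⟨ take-drop (k ∸ i ∸ d) d (drop i X) ⟨
    take (k ∸ i ∸ d) (drop d (drop i X))      ≡⟨ cong (take (k ∸ i ∸ d)) (drop-drop i d X) ⟩
    take (k ∸ i ∸ d) (drop (i + d) X)
      ≡⟨ cong₂ (λ u v → take u (drop v X)) (∸-+-assoc k i d) i+d≡j ⟩
    take (k ∸ (i + d)) (drop j X)             ≡⟨ cong (λ z → take (k ∸ z) (drop j X)) i+d≡j ⟩
    take (k ∸ j) (drop j X)                   ∎)
    where
    open ≡-Reasoning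
    d = j ∸ i
    i+d≡j : i + d ≡ j
    i+d≡j = m+[n∸m]≡n i≤j
    d≤ : d ≤ k ∸ i
    d≤ = ∸-monoˡ-≤ i j≤k

  sub-∷ : ∀ (X : List A) {i j} → i ≤ j → j < length X → ∃[ a ] ∃[ r ] sub _≟_ X i (suc j) ≡ a ∷ r
  sub-∷ X {i} {j} i≤j j<X with a , split ← drop-∷-drop-suc X (≤-<-trans i≤j j<X)
    rewrite +-∸-assoc 1 i≤j | split = a , take (j ∸ i) (drop (suc i) X) , refl

  sub-singleton : ∀ (X : List A) {i} → i < length X → ∃[ a ] sub _≟_ X i (suc i) ≡ a ∷ []
  sub-singleton X {i} i<X with a , split ← drop-∷-drop-suc X i<X
    rewrite m+n∸n≡m 1 i | split = a , refl

  lzSize-reverse-prefix : ∀ {X d i j k} → SelfedLE _≟_ (sub _≟_ X i k) d → j ≤ k →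
                          lzSize _≟_ (reverse (sub _≟_ X i j)) ≤ 2 * d
  lzSize-reverse-prefix {X} {d} {i} {j} {k} selfed j≤k
    rewrite sub-take X {i} {j} {k} j≤k | reverse-take (j ∸ i) (sub _≟_ X i k) =
    lzSize≤2*selfed (drop (length (sub _≟_ X i k) ∸ (j ∸ i)) (reverse (sub _≟_ X i k)))
                    (selfed-drop (length (sub _≟_ X i k) ∸ (j ∸ i)) (selfed-reverse selfed))

  lzSize-suffix : ∀ {X d i j k} → SelfedLE _≟_ (sub _≟_ X i k) d → i ≤ j → j ≤ k →
                  lzSize _≟_ (sub _≟_ X j k) ≤ 2 * d
  lzSize-suffix {X} {i = i} {j} {k} selfed i≤j j≤k rewrite sub-drop X i≤j j≤k =
    lzSize≤2*selfed (drop (j ∸ i) (sub _≟_ X i k)) (selfed-drop (j ∸ i) selfed)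

  lzSize-reverse : ∀ {X d} → SelfedLE _≟_ X d → lzSize _≟_ (reverse X) ≤ 2 * d
  lzSize-reverse {X} selfed = lzSize≤2*selfed (reverse X) (selfed-reverse selfed)

module BlackComponents {A : Set} (_≟_ : DecidableEquality A) (P T : List A) (S : List Alignment) where

  Conn-trans : ∀ {u v w} → Conn _≟_ P T S u v → Conn _≟_ P T S v w → Conn _≟_ P T S u w
  Conn-trans here      vw = vw
  Conn-trans (fwd e c) vw = fwd e (Conn-trans c vw)
  Conn-trans (bwd e c) vw = bwd e (Conn-trans c vw)

  Conn-sym : ∀ {u v} → Conn _≟_ P T S u v → Conn _≟_ P T S v u
  Conn-sym here      = here
  Conn-sym (fwd e c) = Conn-trans (Conn-sym c) (bwd e here)
  Conn-sym (bwd e c) = Conn-trans (Conn-sym c) (fwd e here)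

  Black-Conn : ∀ {u v} → Black _≟_ P T S u → Conn _≟_ P T S u v → Black _≟_ P T S v
  Black-Conn black-u u~v w w′ red v~w = black-u w w′ red (Conn-trans u~v v~w)

  edgesW-covers-P : ∀ {P′ Y st c} → Al _≟_ P′ Y st c → ∀ px py x → px ≤ x → x < px + length P′ →
                    ∃[ v ] ∃[ r ] (pv x , v , r) ∈ edgesW _≟_ P′ Y px py st ×
                                  (r ≡ true ⊎ ∃[ y ] v ≡ tv y × y < py + length Y)
  edgesW-covers-P al-nil px _ x px≤x x<px+0 =
    ⊥-elim (<⇒≱ x<px+0 (subst (_≤ x) (sym (+-identityʳ px)) px≤x))
  edgesW-covers-P (al-diag {xs = xs} {ys} al) px py x px≤x x< with m≤n⇒m<n∨m≡n px≤x
  ... | inj₂ refl = tv py , _ , here refl , inj₂ (py , refl , m<m+n py z<s)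
  ... | inj₁ px<x with edgesW-covers-P al (suc px) (suc py) x px<x (subst (x <_) (+-suc px (length xs)) x<)
  ...   | v , r , e , inj₁ red            = v , r , there e , inj₁ red
  ...   | v , r , e , inj₂ (y , refl , y<) =
    v , r , there e , inj₂ (y , refl , subst (y <_) (sym (+-suc py (length ys))) y<)
  edgesW-covers-P (al-del {xs = xs} {[]} al) px py x px≤x x< with m≤n⇒m<n∨m≡n px≤x
  ... | inj₂ refl = bot , true , here refl , inj₁ refl
  ... | inj₁ px<x with v , r , e , to ← edgesW-covers-P al (suc px) py x px<x (subst (x <_) (+-suc px (length xs)) x<)
    = v , r , there e , to
  edgesW-covers-P (al-del {xs = xs} {_ ∷ _} al) px py x px≤x x< with m≤n⇒m<n∨m≡n px≤x
  ... | inj₂ refl = bot , true , here refl , inj₁ refl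
  ... | inj₁ px<x with v , r , e , to ← edgesW-covers-P al (suc px) py x px<x (subst (x <_) (+-suc px (length xs)) x<)
    = v , r , there e , to
  edgesW-covers-P (al-ins {xs = []} al) px _ x px≤x x<px+0 =
    ⊥-elim (<⇒≱ x<px+0 (subst (_≤ x) (sym (+-identityʳ px)) px≤x))
  edgesW-covers-P (al-ins {xs = _ ∷ _} {ys} al) px py x px≤x x< with edgesW-covers-P al px (suc py) x px≤x x<
  ... | v , r , e , inj₁ red            = v , r , there e , inj₁ red
  ... | v , r , e , inj₂ (y , refl , y<) =
    v , r , there e , inj₂ (y , refl , subst (y <_) (sym (+-suc py (length ys))) y<)

  length-sub≤ : ∀ (X : List A) {i j} → i ≤ j → i + length (sub _≟_ X i j) ≤ j
  length-sub≤ X {i} {j} i≤j = subst (i + length (sub _≟_ X i j) ≤_) (m+[n∸m]≡n i≤j)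
    (+-monoʳ-≤ i (subst (_≤ j ∸ i) (sym (length-take (j ∸ i) (drop i X))) (m⊓n≤m (j ∸ i) _)))

  -- An alignment of S aligns every character of P, so a black one is matched to a character of T.
  black-reaches-T : ∀ {k a} → ValidS _≟_ P T k S → a ∈ S →
                    ∀ v → IsChar _≟_ P T v → Black _≟_ P T S v → ∃[ y ] y < length T × Conn _≟_ P T S v (tv y)
  black-reaches-T _ _ (tv y) y<T _ = y , y<T , here
  black-reaches-T {a = a} valid a∈S (pv x) x<P black
    with ys≤ye , ye≤T , c , al , _ ← All.lookup valid a∈S
    with edgesW-covers-P al 0 (ystart a) x z≤n x<P
  ... | v , true , e , _ = ⊥-elim (black (pv x) v (a , a∈S , e) here)
  ... | v , false , e , inj₂ (y , refl , y<) =
    y , <-≤-trans y< (≤-trans (length-sub≤ T ys≤ye) ye≤T) , fwd (a , a∈S , e) here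

  blackCount≤length : ∀ {k a b Ts} → ValidS _≟_ P T k S → a ∈ S → BlackCount _≟_ P T S b →
                      IsTS _≟_ P T S Ts → b ≤ length Ts
  blackCount≤length {Ts = Ts} valid a∈S (R , refl , chars , disconnected , _) (_ , Ts-black) =
    let (ys , reach , ys⊆Ts) = witnesses R chars
    in subst (_≤ length Ts) (sym (Pointwise-length reach))
             (distinct-⊆⇒length≤ ys Ts (distinct reach disconnected) ys⊆Ts)
    where
    Reaches : V → ℕ → Set
    Reaches v y = Conn _≟_ P T S v (tv y)

    witnesses : ∀ R → All (λ v → IsChar _≟_ P T v × Black _≟_ P T S v) R →
                ∃[ ys ] Pointwise Reaches R ys × All (_∈ Ts) ys
    witnesses []      []                   = [] , [] , []
    witnesses (v ∷ R) ((v-char , black) ∷ chars) =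
      let (y , y<T , v~y) = black-reaches-T valid a∈S v v-char black
          (ys , reach , ys⊆Ts) = witnesses R chars
      in y ∷ ys , v~y ∷ reach , proj₂ (Ts-black y) y<T (Black-Conn black v~y) ∷ ys⊆Ts

    distinct : ∀ {R ys} → Pointwise Reaches R ys → AllPairs (λ u v → ¬ Conn _≟_ P T S u v) R →
               AllPairs _≢_ ys
    distinct []            []                   = []
    distinct (v~y ∷ reach) (v≁R ∷ disconnected) = apart reach v≁R ∷ distinct reach disconnected
      where
      apart : ∀ {R ys} → Pointwise Reaches R ys → All (λ u → ¬ Conn _≟_ P T S _ u) R → All (_ ≢_) ys
      apart []            []          = []
      apart (u~z ∷ reach) (v≁u ∷ v≁R) =
        (λ { refl → v≁u (Conn-trans v~y (Conn-sym u~z)) }) ∷ apart reach v≁R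

module PeriodCover {A : Set} (_≟_ : DecidableEquality A) (P T : List A) (k w b : ℕ) (Ps Ts : List ℕ)
                   (wS : ℕ → ℕ) (0<b : 0 < b) (b≤Ts : b ≤ length Ts) (Ts-sorted : Linked _<_ Ts)
                   (Ts-in-T : ∀ {y} → y ∈ Ts → y < length T) where
  open Derived _≟_ P T k w b Ps Ts wS
  open Alignments _≟_
  open Windows _≟_

  τ₀≡nth : ∀ x → τ x 0 ≡ nth Ts x
  τ₀≡nth x = cong (nth Ts) (+-identityʳ x)

  τ₀-in-T : ∀ {x} → x < b → τ x 0 < length T
  τ₀-in-T {x} x<b rewrite τ₀≡nth x = Ts-in-T (nth-∈ Ts (<-≤-trans x<b b≤Ts))

  τ₀-mono : ∀ {x y} → x ≤ y → y < b → τ x 0 ≤ τ y 0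
  τ₀-mono {x} {y} x≤y y<b rewrite τ₀≡nth x | τ₀≡nth y =
    nth-mono (Linked⇒AllPairs <-trans Ts-sorted) x≤y (<-≤-trans y<b b≤Ts)

  selfed-window-pos : ∀ {a b′ d} → a ≤ b′ → b′ < b → SelfedLE _≟_ (Tij a b′) d → 1 ≤ d
  selfed-window-pos {a} {b′} {d} a≤b′ b′<b selfed
    with _ , _ , nonempty ← sub-∷ T (τ₀-mono a≤b′ b′<b) (τ₀-in-T b′<b) =
    selfed-nonempty (subst (λ X → SelfedLE _≟_ X d) nonempty selfed)

  lzSize-singleton-window : ∀ {x} → x < b → lzSize _≟_ (Tij x x) ≤ 1 × lzSize _≟_ (reverse (Tij x x)) ≤ 1
  lzSize-singleton-window {x} x<b with _ , single ← sub-singleton T (τ₀-in-T x<b) rewrite single =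
    ≤-refl , ≤-refl

  W-mono : ∀ {i a b′ j} → i ≤ a → a ≤ b′ → b′ ≤ j → W a b′ ≤ W i j
  W-mono {i} {a} {b′} {j} i≤a a≤b′ b′≤j with m≤n⇒m<n∨m≡n i≤a
  ... | inj₂ refl = +-monoʳ-≤ (wS' a) (windowSum-mono wS a (suc b′ ∸ a) a (suc j ∸ a) ≤-refl ends)
    where
    ends : a + (suc b′ ∸ a) ≤ a + (suc j ∸ a)
    ends = subst₂ _≤_ (sym (m+[n∸m]≡n (m≤n⇒m≤1+n a≤b′)))
                      (sym (m+[n∸m]≡n (m≤n⇒m≤1+n (≤-trans a≤b′ b′≤j))))
                      (s≤s b′≤j)
  W-mono {i} {suc a} {b′} {j} _ a<b′ b′≤j | inj₁ (s≤s i≤a) =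
    ≤-trans (subst (_≤ windowSum wS i (suc j ∸ i)) (windowSum-suc wS a (b′ ∸ a))
                   (windowSum-mono wS a (suc (b′ ∸ a)) i (suc j ∸ i) i≤a ends))
            (m≤n+m _ (wS' i))
    where
    ends : a + suc (b′ ∸ a) ≤ i + (suc j ∸ i)
    ends = subst₂ _≤_ (sym (trans (+-suc a (b′ ∸ a)) (cong suc (m+[n∸m]≡n (<⇒≤ a<b′)))))
                      (sym (m+[n∸m]≡n (m≤n⇒m≤1+n (≤-trans i≤a (≤-trans (<⇒≤ a<b′) b′≤j)))))
                      (s≤s b′≤j)

  CompressibleSplits : ℕ → ℕ → ℕ → Set
  CompressibleSplits a b′ t = ∀ {h} → a ≤ h → h < b′ →
    lzSize _≟_ (reverse (Tij a h)) ≤ t × lzSize _≟_ (sub _≟_ T (suc (τ h 0)) (suc (τ b′ 0))) ≤ t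

  -- The recursion descends into the half containing [a..b′]; once the midpoint h splits [a..b′],
  -- the interval [i′..j′] of that level already contains it.
  memC-⊇ : ∀ fuel {i j a b′} → j < i + fuel → i ≤ a → a ≤ b′ → b′ ≤ j → 1 ≤ W a b′ →
           CompressibleSplits a b′ (12 * W a b′) → ∀ {c} → a ≤ c → c ≤ b′ → memC fuel i j c
  memC-⊇ zero {i} {j} j<i+0 i≤a a≤b′ b′≤j _ _ _ _ =
    ⊥-elim (<⇒≱ j<i+0 (subst (_≤ j) (sym (+-identityʳ i)) (≤-trans i≤a (≤-trans a≤b′ b′≤j))))
  memC-⊇ (suc fuel) {i} {j} {a} {b′} j<i+1+fuel i≤a a≤b′ b′≤j 0<W splits {c} a≤c c≤b′
    with W i j ≡ᵇ 0 in W≡0 | i ≡ᵇ j in i≡j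
  ... | true | _ =
    <⇒≱ (<-≤-trans 0<W (W-mono i≤a a≤b′ b′≤j))
        (≤-reflexive (≡ᵇ⇒≡ (W i j) 0 (Equivalence.from T-≡ W≡0)))
  ... | false | true =
    ≤-antisym (≤-trans c≤b′ (≤-trans b′≤j (≤-reflexive (sym (≡ᵇ⇒≡ i j (Equivalence.from T-≡ i≡j))))))
              (≤-trans i≤a a≤c)
  ... | false | false
    with i<j ← ≤∧≢⇒< (≤-trans i≤a (≤-trans a≤b′ b′≤j)) (subst Data.Bool.T i≡j ∘ ≡⇒≡ᵇ i j)
       | j≤i+fuel ← ≤-pred (subst (j <_) (+-suc i fuel) j<i+1+fuel)
       | b′ ≤? (i + j) / 2 | a ≤? (i + j) / 2
  ... | yes b′≤h | _ =
    inj₁ (memC-⊇ fuel (<-≤-trans ([m+n]/2<n i<j) j≤i+fuel) i≤a a≤b′ b′≤h 0<W splits a≤c c≤b′)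
  ... | no _ | no a≰h =
    inj₂ (inj₁ (memC-⊇ fuel (s≤s (≤-trans j≤i+fuel (+-monoˡ-≤ fuel (m≤[m+n]/2 (<⇒≤ i<j)))))
                       (≰⇒> a≰h) a≤b′ b′≤j 0<W splits a≤c c≤b′))
  ... | no b′≰h | yes a≤h =
    inj₂ (inj₂ (InIvl-intro
      (smallestIn-≤ _ i≤a a≤h (≤⇒≤ᵇ≡true (≤-trans (proj₁ split) 12W≤)))
      (largestIn-≥ _ (<⇒≤ h<b′) b′≤j (≤⇒≤ᵇ≡true (≤-trans (proj₂ split) 12W≤)))
      a≤c c≤b′))
    where
    h<b′ = ≰⇒> b′≰h
    split = splits a≤h h<b′
    12W≤ = *-monoʳ-≤ 12 (W-mono i≤a a≤b′ b′≤j)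

  selfedBound : ℕ
  selfedBound = 6 * w + 11 * k

  2*selfedBound≡bound : 2 * selfedBound ≡ bound
  2*selfedBound≡bound =
    trans (*-distribˡ-+ 2 (6 * w) (11 * k)) (cong₂ _+_ (sym (*-assoc 2 6 w)) (sym (*-assoc 2 11 k)))

  lzSize-window≤bound : ∀ {a b′} → SelfedLE _≟_ (Tij a b′) selfedBound → lzSize _≟_ (Tij a b′) ≤ bound
  lzSize-window≤bound {a} {b′} selfed =
    subst (lzSize _≟_ (Tij a b′) ≤_) 2*selfedBound≡bound
          (SelfAlignmentParse.lzSize≤2*selfed _≟_ (Tij a b′) selfed)

  lzSize-reverse-window≤bound : ∀ {a b′} → SelfedLE _≟_ (Tij a b′) selfedBound →
                                lzSize _≟_ (reverse (Tij a b′)) ≤ bound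
  lzSize-reverse-window≤bound {a} {b′} selfed =
    subst (lzSize _≟_ (reverse (Tij a b′)) ≤_) 2*selfedBound≡bound (lzSize-reverse selfed)

  bound-pos : ∀ {a b′} → a ≤ b′ → b′ < b → SelfedLE _≟_ (Tij a b′) selfedBound → 1 ≤ bound
  bound-pos a≤b′ b′<b selfed =
    ≤-trans (selfed-window-pos a≤b′ b′<b selfed) (≤-trans (m≤m+n _ _) (≤-reflexive 2*selfedBound≡bound))

  clpref-≥ : ∀ {b′} → suc clast ≤ b′ → b′ < b → lzSize _≟_ (Tij (suc clast) b′) ≤ bound →
             JustAtLeast clpref b′
  clpref-≥ {b′} clast<b′ b′<b lz≤ rewrite <⇒<ᵇ≡true (<-≤-trans (s≤s clast<b′) b′<b) =
    largestIn-≥ _ clast<b′ (<⇒≤∸1 b′<b) (≤⇒≤ᵇ≡true lz≤)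

  clpref-≥-clast : 1 ≤ bound → JustAtLeast clpref clast
  clpref-≥-clast 0<bound with suc clast <ᵇ b in clast+1<b
  ... | false = clast , refl , ≤-refl
  ... | true with clast+1<b′ ← <ᵇ⇒< (suc clast) b (Equivalence.from T-≡ clast+1<b)
    with r , found , ≤r ← largestIn-≥ _ ≤-refl (<⇒≤∸1 clast+1<b′)
                            (≤⇒≤ᵇ≡true (≤-trans (proj₁ (lzSize-singleton-window clast+1<b′)) 0<bound))
    = r , found , ≤-trans (n≤1+n clast) ≤r

  clast<b : clast < b
  clast<b = modN<n (length Ps ∸ 1) 0<b

  cover-from-first : ∀ {b′} → b′ < b → SelfedLE _≟_ (Tij 0 b′) selfedBound → ∀ {c} → c ≤ b′ → CS c
  cover-from-first b′<b selfed c≤b′ =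
    inj₁ (InIvl-intro (0 , refl , z≤n)
                      (largestIn-≥ _ z≤n (<⇒≤∸1 b′<b) (≤⇒≤ᵇ≡true (lzSize-window≤bound selfed)))
                      z≤n c≤b′)

  cover-to-last : ∀ {a} → a ≤ b ∸ 1 → SelfedLE _≟_ (Tij a (b ∸ 1)) selfedBound →
                  ∀ {c} → a ≤ c → c ≤ b ∸ 1 → CS c
  cover-to-last a≤ selfed a≤c c≤ =
    inj₂ (inj₁ (InIvl-intro (smallestIn-≤ _ z≤n a≤ (≤⇒≤ᵇ≡true (lzSize-reverse-window≤bound selfed)))
                            (b ∸ 1 , refl , ≤-refl) a≤c c≤))

  cover-to-clast : ∀ {a} → a ≤ clast → SelfedLE _≟_ (Tij a clast) selfedBound →
                   ∀ {c} → a ≤ c → c ≤ clast → CS c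
  cover-to-clast a≤clast selfed a≤c c≤clast =
    inj₂ (inj₂ (inj₁ (InIvl-intro
      (smallestIn-≤ _ z≤n a≤clast (≤⇒≤ᵇ≡true (lzSize-reverse-window≤bound selfed)))
      (clpref-≥-clast (bound-pos a≤clast clast<b selfed)) a≤c c≤clast)))

  cover-from-after-clast : ∀ {b′} → suc clast ≤ b′ → b′ < b →
                           SelfedLE _≟_ (Tij (suc clast) b′) selfedBound →
                           ∀ {c} → suc clast ≤ c → c ≤ b′ → CS c
  cover-from-after-clast clast<b′ b′<b selfed clast<c c≤b′ =
    inj₂ (inj₂ (inj₁ (InIvl-intro clsuff≤clast (clpref-≥ clast<b′ b′<b (lzSize-window≤bound selfed))
                                  (<⇒≤ clast<c) c≤b′)))
    where
    clsuff≤clast : JustAtMost clsuff clast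
    clsuff≤clast = smallestIn-≤ _ z≤n ≤-refl
      (≤⇒≤ᵇ≡true (≤-trans (proj₂ (lzSize-singleton-window clast<b)) (bound-pos clast<b′ b′<b selfed)))

  cover-weighted : ∀ {a b′} → a ≤ b′ → b′ < b → SelfedLE _≟_ (Tij a b′) (6 * W a b′) →
                   ∀ {c} → a ≤ c → c ≤ b′ → CS c
  cover-weighted {a} {b′} a≤b′ b′<b selfed a≤c c≤b′ =
    inj₂ (inj₂ (inj₂ (memC-⊇ b (∸-monoʳ-< z<s 0<b) z≤n a≤b′ (<⇒≤∸1 b′<b) 0<W splits
                              a≤c c≤b′)))
    where
    0<W : 1 ≤ W a b′
    0<W = *-cancelˡ-< 6 0 (W a b′) (selfed-window-pos a≤b′ b′<b selfed)
    splits : CompressibleSplits a b′ (12 * W a b′)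
    splits {h} a≤h h<b′ =
      subst (lzSize _≟_ (reverse (Tij a h)) ≤_) 2*6W≡12W
            (lzSize-reverse-prefix {T} {6 * W a b′} {τ a 0} selfed (s≤s τh≤τb′)) ,
      subst (lzSize _≟_ (sub _≟_ T (suc (τ h 0)) (suc (τ b′ 0))) ≤_) 2*6W≡12W
            (lzSize-suffix {T} {6 * W a b′} selfed (m≤n⇒m≤1+n (τ₀-mono a≤h (<-trans h<b′ b′<b)))
                           (s≤s τh≤τb′))
      where
      2*6W≡12W : 2 * (6 * W a b′) ≡ 12 * W a b′
      2*6W≡12W = sym (*-assoc 2 6 (W a b′))
      τh≤τb′ : τ h 0 ≤ τ b′ 0
      τh≤τb′ = τ₀-mono (<⇒≤ h<b′) b′<b

  CS-isPeriodCover : IsPeriodCover CS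
  CS-isPeriodCover .0 b′ _ b′<b (inj₁ (selfed , inj₁ refl)) _ _ c≤b′ =
    cover-from-first b′<b selfed c≤b′
  CS-isPeriodCover a .(b ∸ 1) a≤b′ _ (inj₁ (selfed , inj₂ (inj₁ refl))) _ a≤c c≤b′ =
    cover-to-last a≤b′ selfed a≤c c≤b′
  CS-isPeriodCover a .clast a≤b′ _ (inj₁ (selfed , inj₂ (inj₂ (inj₁ refl)))) _ a≤c c≤b′ =
    cover-to-clast a≤b′ selfed a≤c c≤b′
  CS-isPeriodCover .(suc clast) b′ a≤b′ b′<b (inj₁ (selfed , inj₂ (inj₂ (inj₂ refl)))) _ a≤c c≤b′ =
    cover-from-after-clast a≤b′ b′<b selfed a≤c c≤b′
  CS-isPeriodCover a b′ a≤b′ b′<b (inj₂ selfed) _ a≤c c≤b′ =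
    cover-weighted a≤b′ b′<b selfed a≤c c≤b′

lemma4p11 : ∀ {A : Set} (_≟_ : DecidableEquality A) (P T : List A) (k : ℕ) (S : List Alignment) →
  ValidS _≟_ P T k S → Encloses _≟_ P T k S →
  ∀ (b : ℕ) → BlackCount _≟_ P T S b → 0 < b →
  ∀ (Ps : List ℕ) → IsPS _≟_ P T S Ps →
  ∀ (Ts : List ℕ) → IsTS _≟_ P T S Ts →
  ∀ (w : ℕ) (wS : ℕ → ℕ) →
  Derived.Covers _≟_ P T k w b Ps Ts wS → sum (map wS (upTo b)) ≤ w →
  Derived.IsPeriodCover _≟_ P T k w b Ps Ts wS (Derived.CS _≟_ P T k w b Ps Ts wS)
lemma4p11 _≟_ P T k S valid (_ , (_ , a∈S , _) , _) b blackCount 0<b Ps _ Ts isTs@(Ts-sorted , Ts-black) w wS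
          _ _ =
  PeriodCover.CS-isPeriodCover _≟_ P T k w b Ps Ts wS 0<b
    (BlackComponents.blackCount≤length _≟_ P T S valid a∈S blackCount isTs)
    Ts-sorted (λ {y} y∈Ts → proj₁ (proj₁ (Ts-black y) y∈Ts))
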